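{- Let $\mathcal{A}$ be a finite totally ordered alphabet and let $w \in \mathcal{A}^{+}$ be a Lyndon word with $|w| \geq F_{n}$ for some integer $n \geq 3$. Then $\mathcal{L}(w) \geq n$, with equality if and only if $w$ is a Fibonacci Lyndon word of length $F_{n}$.
   Context: Words over $\mathcal{A}$ are compared in the lexicographic order: $u < v$ iff $u$ is a proper prefix of $v$, or $u = x\mathtt{a}u'$, $v = x\mathtt{b}v'$ with letters $\mathtt{a} < \mathtt{b}$. A Lyndon word is a nonempty primitive word that is strictly smallest in its conjugacy class (letters are Lyndon words). $\mathcal{L}(w)$ denotes the number of distinct factors of $w$ that are Lyndon words. Fibonacci numbers: $F_0=0$, $F_1=1$, $F_n=F_{n-1}+F_{n-2}$. For distinct letters $\mathtt{a}<\mathtt{b}$ in $\mathcal{A}$, define $f_1=\mathtt{b}$, $f_2=\mathtt{a}$, $f_n=f_{n-1}f_{n-2}$ ($n\ge 3$), and for $n \geq 3$ let $p_n$ be the word with $f_n = p_n xy$, $xy\in\{\mathtt{ab},\mathtt{ba}\}$ (so $|p_n|=F_n-2$). Let $c$ be the morphism exchanging $\mathtt{a}$ and $\mathtt{b}$. The Fibonacci Lyndon words of length $F_n$ over $\{\mathtt{a},\mathtt{b}\}$ are $\mathtt{a}p_n\mathtt{b}$ and $\mathtt{a}c(p_n)\mathtt{b}$; a Fibonacci Lyndon word of length $F_n$ is such a word for some letters $\mathtt{a}<\mathtt{b}$ of $\mathcal{A}$. -}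

module Defs where

open import Data.Nat using (ℕ; zero; suc; _+_; _∸_; _≤_)
open import Data.Fin using (Fin) renaming (_<_ to _<ᶠ_)
open import Data.Fin.Properties using (_≟_)
open import Data.List using (List; []; _∷_; _++_; concat; replicate; take; map; length)
open import Data.List.Relation.Unary.Unique.Propositional using (Unique)
open import Data.List.Membership.Propositional using (_∈_)
open import Data.Product using (Σ; ∃; _×_; _,_)
open import Data.Sum using (_⊎_)
open import Relation.Nullary using (¬_; yes; no)
open import Relation.Binary.PropositionalEquality using (_≡_; _≢_)
open import Function.Bundles using (_⇔_)

-- The finite totally ordered alphabet is Fin k with its usual order
-- (every finite totally ordered set is order-isomorphic to some Fin k).
Word : ℕ → Set
Word k = List (Fin k)

data _<lex_ {k : ℕ} : Word k → Word k → Set where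
  prefix : ∀ {y ys} → [] <lex (y ∷ ys)
  here   : ∀ {x y xs ys} → x <ᶠ y → (x ∷ xs) <lex (y ∷ ys)
  there  : ∀ {x xs ys} → xs <lex ys → (x ∷ xs) <lex (x ∷ ys)

Primitive : ∀ {k} → Word k → Set
Primitive w = ¬ (Σ _ λ u → Σ ℕ λ j → (2 ≤ j) × (w ≡ concat (replicate j u)))

Conjugate : ∀ {k} → Word k → Word k → Set
Conjugate w v = Σ _ λ x → Σ _ λ y → (w ≡ x ++ y) × (v ≡ y ++ x)

Lyndon : ∀ {k} → Word k → Set
Lyndon w = (w ≢ []) × Primitive w × (∀ v → Conjugate w v → v ≢ w → w <lex v)

Factor : ∀ {k} → Word k → Word k → Set
Factor u w = Σ _ λ x → Σ _ λ y → w ≡ x ++ u ++ y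

-- LyndonCount w m : the number of distinct Lyndon factors of w is m,
-- i.e. m is the length of a duplicate-free list enumerating exactly them.
LyndonCount : ∀ {k} → Word k → ℕ → Set
LyndonCount {k} w m =
  Σ (List (Word k)) λ ls → Unique ls × (∀ u → (u ∈ ls) ⇔ (Factor u w × Lyndon u)) × (length ls ≡ m)

fib : ℕ → ℕ
fib 0 = 0
fib 1 = 1
fib (suc (suc n)) = fib (suc n) + fib n

fibWord : ∀ {k} → Fin k → Fin k → ℕ → Word k
fibWord a b 0 = []
fibWord a b 1 = b ∷ []
fibWord a b 2 = a ∷ []
fibWord a b (suc (suc (suc n))) = fibWord a b (suc (suc n)) ++ fibWord a b (suc n)

pWord : ∀ {k} → Fin k → Fin k → ℕ → Word k
pWord a b n = take (fib n ∸ 2) (fibWord a b n)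

swapLetter : ∀ {k} → Fin k → Fin k → Fin k → Fin k
swapLetter a b x with x ≟ a
... | yes _ = b
... | no _ with x ≟ b
...   | yes _ = a
...   | no _ = x

cMorph : ∀ {k} → Fin k → Fin k → Word k → Word k
cMorph a b = map (swapLetter a b)

FibLyndon : ∀ {k} → ℕ → Word k → Set
FibLyndon {k} n w =
  Σ (Fin k) λ a → Σ (Fin k) λ b → (a <ᶠ b) ×
    ((w ≡ a ∷ (pWord a b n ++ b ∷ [])) ⊎ (w ≡ a ∷ (cMorph a b (pWord a b n) ++ b ∷ [])))

module Submission where

-- 1. Lyndon words are the nonempty words smaller than all their proper suffixes
--    ('SuffixMinimal'); such a word of length ≥ 2 is a product u v of two Lyndon
--    words (standard factorisation, v its smallest proper suffix).
-- 2. Lower bound: restricting a list of the Lyndon factors of w = u v to the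
--    factors of u and of v loses w, and one of the two restrictions also loses v
--    resp. u.  Induction gives |w| ≤ F_m, hence n ≤ m ('length-≤-fib-cover').
-- 3. Over {𝚊 < 𝚋}, 'fibLyndon t i' arises from 𝚊𝚋 by alternately applying the
--    morphisms 𝚊 ↦ 𝚊, 𝚋 ↦ 𝚊𝚋 and 𝚊 ↦ 𝚊𝚋, 𝚋 ↦ 𝚋.  These words are Lyndon, satisfy the
--    Fibonacci recurrence, and by desubstitution their Lyndon factors are the two
--    letters and the earlier words of the family: i + 3 words ('fibLyndon-count-≤').
-- 4. If m = n, every inequality of step 2 is tight: both standard factors are
--    extremal again and the shorter is a factor of the longer, so by induction w is
--    conjugate, hence equal, to a renamed 'fibLyndon t i' ('extremal-is-fibonacci').
-- 5. Renamed along a < b, 'fibLyndon t i' is a p_{i+3} b resp. a c(p_{i+3}) b, and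
--    the theorem combines 2, 3 and 4.

open import Defs
open import Data.Nat using (ℕ; zero; suc; _+_; _∸_; _≤_; _<_; z≤n; s≤s)
import Data.Nat.Properties as ℕP
open import Data.Fin using (Fin; zero; suc) renaming (_<_ to _<ᶠ_)
import Data.Fin.Properties as FinP
open import Data.List using (List; []; _∷_; _++_; _∷ʳ_; _∷ʳ′_; length; map; filter; take; concat; concatMap; replicate; applyUpTo; initLast)
import Data.List.Properties as ListP
open import Data.List.Membership.Propositional using (_∈_)
import Data.List.Membership.Propositional.Properties as ∈P
open import Data.List.Relation.Unary.Any using (here; there)
import Data.List.Relation.Unary.Any as Any
open import Data.List.Relation.Unary.All using (lookup)
open import Data.List.Relation.Unary.AllPairs using (_∷_)
open import Data.List.Relation.Unary.Unique.Propositional using (Unique)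
open import Data.Bool using (Bool; true; false; not)
open import Data.Product using (Σ; _×_; _,_; proj₁; proj₂)
open import Data.Sum using (_⊎_; inj₁; inj₂)
open import Data.Empty using (⊥; ⊥-elim)
open import Data.Unit using (⊤; tt)
open import Relation.Nullary using (¬_; Dec; yes; no; ¬?)
open import Relation.Unary using (Decidable)
open import Relation.Binary.Definitions using (DecidableEquality; tri<; tri≈; tri>)
open import Relation.Binary.PropositionalEquality
open import Function.Bundles using (_⇔_; Equivalence; mk⇔)

module _ {k : ℕ} where

  lex-asym : ∀ {u v : Word k} → u <lex v → v <lex u → ⊥
  lex-asym prefix ()
  lex-asym (here p) (here q) = FinP.<-asym p q
  lex-asym (here p) (there q) = FinP.<-irrefl refl p
  lex-asym (there p) (here q) = FinP.<-irrefl refl q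
  lex-asym (there p) (there q) = lex-asym p q

  lex-irrefl : ∀ {u : Word k} → u <lex u → ⊥
  lex-irrefl p = lex-asym p p

  lex-trans : ∀ {u v w : Word k} → u <lex v → v <lex w → u <lex w
  lex-trans prefix (here _) = prefix
  lex-trans prefix (there _) = prefix
  lex-trans (here p) (here q) = here (FinP.<-trans p q)
  lex-trans (here p) (there q) = here p
  lex-trans (there p) (here q) = here q
  lex-trans (there p) (there q) = there (lex-trans p q)

  lex-trichotomy : (u v : Word k) → u <lex v ⊎ u ≡ v ⊎ v <lex u
  lex-trichotomy [] [] = inj₂ (inj₁ refl)
  lex-trichotomy [] (_ ∷ _) = inj₁ prefix
  lex-trichotomy (_ ∷ _) [] = inj₂ (inj₂ prefix)
  lex-trichotomy (x ∷ xs) (y ∷ ys) with FinP.<-cmp x y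
  ... | tri< p _ _ = inj₁ (here p)
  ... | tri> _ _ p = inj₂ (inj₂ (here p))
  ... | tri≈ _ refl _ with lex-trichotomy xs ys
  ...   | inj₁ p = inj₁ (there p)
  ...   | inj₂ (inj₁ refl) = inj₂ (inj₁ refl)
  ...   | inj₂ (inj₂ p) = inj₂ (inj₂ (there p))

  lex-++ˡ : ∀ (p : Word k) {u v} → u <lex v → (p ++ u) <lex (p ++ v)
  lex-++ˡ [] q = q
  lex-++ˡ (x ∷ p) q = there (lex-++ˡ p q)

  lex-cancelˡ : ∀ (p : Word k) {u v} → (p ++ u) <lex (p ++ v) → u <lex v
  lex-cancelˡ [] q = q
  lex-cancelˡ (x ∷ p) (there q) = lex-cancelˡ p q
  lex-cancelˡ (x ∷ p) (here q) = ⊥-elim (FinP.<-irrefl refl q)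

  lex-proper-prefix : ∀ (u : Word k) {c s} → u <lex (u ++ c ∷ s)
  lex-proper-prefix [] = prefix
  lex-proper-prefix (x ∷ u) = there (lex-proper-prefix u)

  Mismatch : Word k → Word k → Set
  Mismatch u v = Σ (Word k) λ p → Σ (Fin k) λ c → Σ (Fin k) λ d → Σ (Word k) λ u' → Σ (Word k) λ v' →
    (c <ᶠ d) × (u ≡ p ++ c ∷ u') × (v ≡ p ++ d ∷ v')

  -- Unlike a prefix relation, a mismatch survives arbitrary extensions.
  mismatch-++ : ∀ {u v : Word k} x y → Mismatch u v → (u ++ x) <lex (v ++ y)
  mismatch-++ x y (p , c , d , u' , v' , c<d , refl , refl)
    rewrite ListP.++-assoc p (c ∷ u') x | ListP.++-assoc p (d ∷ v') y = lex-++ˡ p (here c<d)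

  lex-cases : ∀ {u v : Word k} → u <lex v → (Σ (Fin k) λ c → Σ (Word k) λ s → v ≡ u ++ c ∷ s) ⊎ Mismatch u v
  lex-cases (prefix {y} {ys}) = inj₁ (y , ys , refl)
  lex-cases (here {x} {y} {xs} {ys} p) = inj₂ ([] , x , y , xs , ys , p , refl , refl)
  lex-cases (there {x} q) with lex-cases q
  ... | inj₁ (c , s , refl) = inj₁ (c , s , refl)
  ... | inj₂ (p , c , d , u' , v' , c<d , refl , refl) = inj₂ (x ∷ p , c , d , u' , v' , c<d , refl , refl)

  length-++-< : ∀ (u v : Word k) → v ≢ [] → length u < length (u ++ v)
  length-++-< [] [] v≢[] = ⊥-elim (v≢[] refl)
  length-++-< [] (_ ∷ _) _ = s≤s z≤n
  length-++-< (x ∷ u) v v≢[] = s≤s (length-++-< u v v≢[])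

  length-++-<ʳ : ∀ (u v : Word k) → u ≢ [] → length v < length (u ++ v)
  length-++-<ʳ [] v u≢[] = ⊥-elim (u≢[] refl)
  length-++-<ʳ (x ∷ u) v _ = s≤s (subst (length v ≤_) (sym (ListP.length-++ u)) (ℕP.m≤n+m (length v) (length u)))

  ≢-by-length : ∀ {u v : Word k} → length u < length v → u ≢ v
  ≢-by-length lt refl = ℕP.<-irrefl refl lt

  -- If v is not longer than u, then u <lex v is a mismatch and survives appending.
  lex-++ : ∀ {u v : Word k} x y → u <lex v → length v ≤ length u → (u ++ x) <lex (v ++ y)
  lex-++ {u} x y u<v v≤u with lex-cases u<v
  ... | inj₂ mis = mismatch-++ x y mis
  ... | inj₁ (c , s , refl) = ⊥-elim (ℕP.<-irrefl refl (ℕP.≤-trans (length-++-< u (c ∷ s) (λ ())) v≤u))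

  ++-prefix : ∀ (p q : Word k) {s t} → p ++ s ≡ q ++ t → length p ≤ length q → Σ (Word k) λ r → q ≡ p ++ r
  ++-prefix [] q eq _ = q , refl
  ++-prefix (x ∷ p) (y ∷ q) eq (s≤s le) with ListP.∷-injective eq
  ... | refl , eq' with ++-prefix p q eq' le
  ...   | r , refl = r , refl

  infix 4 _≟ʷ_
  _≟ʷ_ : DecidableEquality (Word k)
  _≟ʷ_ = ListP.≡-dec FinP._≟_

  prefix? : (z w : Word k) → Dec (Σ (Word k) λ t → w ≡ z ++ t)
  prefix? [] w = yes (w , refl)
  prefix? (x ∷ z) [] = no λ { (t , ()) }
  prefix? (x ∷ z) (y ∷ w) with x FinP.≟ y
  ... | no x≢y = no λ { (t , eq) → x≢y (sym (ListP.∷-injectiveˡ eq)) }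
  ... | yes refl with prefix? z w
  ...   | yes (t , eq) = yes (t , cong (x ∷_) eq)
  ...   | no ¬pre = no λ { (t , eq) → ¬pre (t , ListP.∷-injectiveʳ eq) }

  factor? : (z w : Word k) → Dec (Factor z w)
  factor? z [] with prefix? z []
  ... | yes (t , eq) = yes ([] , t , eq)
  ... | no ¬pre = no λ { ([] , y , eq) → ¬pre (y , eq) ; (_ ∷ _ , y , ()) }
  factor? z (c ∷ w) with prefix? z (c ∷ w)
  ... | yes (t , eq) = yes ([] , t , eq)
  ... | no ¬pre with factor? z w
  ...   | yes (x , y , eq) = yes (c ∷ x , y , cong (c ∷_) eq)
  ...   | no ¬fac = no λ { ([] , y , eq) → ¬pre (y , eq) ; (c' ∷ x , y , eq) → ¬fac (x , y , ListP.∷-injectiveʳ eq) }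

  factor-trans : ∀ {u v w : Word k} → Factor u v → Factor v w → Factor u w
  factor-trans {u} (x' , y' , refl) (x , y , refl) = x ++ x' , y' ++ y , eq
    where
      open ≡-Reasoning
      eq : x ++ (x' ++ u ++ y') ++ y ≡ (x ++ x') ++ u ++ (y' ++ y)
      eq = begin
        x ++ (x' ++ u ++ y') ++ y  ≡⟨ cong (x ++_) (ListP.++-assoc x' (u ++ y') y) ⟩
        x ++ x' ++ (u ++ y') ++ y  ≡⟨ cong (λ t → x ++ x' ++ t) (ListP.++-assoc u y' y) ⟩
        x ++ x' ++ u ++ y' ++ y    ≡⟨ sym (ListP.++-assoc x x' (u ++ y' ++ y)) ⟩
        (x ++ x') ++ u ++ y' ++ y  ∎

  factor-refl : ∀ (w : Word k) → Factor w w
  factor-refl w = [] , [] , sym (ListP.++-identityʳ w)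

  factor-++ˡ : ∀ (u v : Word k) → Factor u (u ++ v)
  factor-++ˡ u v = [] , v , refl

  factor-++ʳ : ∀ (u v : Word k) → Factor v (u ++ v)
  factor-++ʳ u v = u , [] , cong (u ++_) (sym (ListP.++-identityʳ v))

  factor-length : ∀ {z w : Word k} → Factor z w → length z ≤ length w
  factor-length {z} (x , y , refl) = begin
    length z                  ≤⟨ ℕP.m≤m+n (length z) (length y) ⟩
    length z + length y       ≡⟨ sym (ListP.length-++ z) ⟩
    length (z ++ y)           ≤⟨ ℕP.m≤n+m _ (length x) ⟩
    length x + length (z ++ y) ≡⟨ sym (ListP.length-++ x) ⟩
    length (x ++ z ++ y)      ∎
    where open ℕP.≤-Reasoning

  factor-length-≡ : ∀ {z w : Word k} → Factor z w → length z ≡ length w → z ≡ w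
  factor-length-≡ {z} ([] , [] , refl) _ = sym (ListP.++-identityʳ z)
  factor-length-≡ {z} ([] , c ∷ y , refl) eq = ⊥-elim (ℕP.<-irrefl eq (length-++-< z (c ∷ y) (λ ())))
  factor-length-≡ {z} (c ∷ x , y , refl) eq = ⊥-elim (ℕP.<-irrefl eq (s≤s (factor-length (x , y , refl))))

  factor-∈ : ∀ {z w : Word k} {c} → Factor z w → c ∈ z → c ∈ w
  factor-∈ {z} (x , y , refl) m = ∈P.∈-++⁺ʳ x (∈P.∈-++⁺ˡ m)

-- Lyndon words as words smaller than all their proper suffixes

module _ {k : ℕ} where

  pow : Word k → ℕ → Word k
  pow u j = concat (replicate j u)

  pow-+ : ∀ (z : Word k) i j → pow z (i + j) ≡ pow z i ++ pow z j
  pow-+ z zero j = refl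
  pow-+ z (suc i) j = trans (cong (z ++_) (pow-+ z i j)) (sym (ListP.++-assoc z (pow z i) (pow z j)))

  pow-[] : ∀ j → pow [] j ≡ []
  pow-[] zero = refl
  pow-[] (suc j) = pow-[] j

  pow-suc : ∀ (z : Word k) j → pow z (suc j) ≡ pow z j ++ z
  pow-suc z j = trans (cong (pow z) (ℕP.+-comm 1 j)) (trans (pow-+ z j 1) (cong (pow z j ++_) (ListP.++-identityʳ z)))

  nonempty⇒length-pos : ∀ {x : Word k} → x ≢ [] → 1 ≤ length x
  nonempty⇒length-pos {[]} x≢[] = ⊥-elim (x≢[] refl)
  nonempty⇒length-pos {_ ∷ _} _ = s≤s z≤n

  CommonRoot : Word k → Word k → Set
  CommonRoot x y = Σ (Word k) λ z → Σ ℕ λ i → Σ ℕ λ j → (1 ≤ i) × (1 ≤ j) × (x ≡ pow z i) × (y ≡ pow z j)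

  -- Lyndon–Schützenberger: commuting nonempty words have a common root.  The
  -- shorter word is a prefix of the longer one, and we recurse on (x , x⁻¹y);
  -- 'fuel' bounds the total length.
  mutual
    commuting⇒common-root : ∀ fuel (x y : Word k) → length x + length y ≤ fuel → x ++ y ≡ y ++ x →
      x ≢ [] → y ≢ [] → CommonRoot x y
    commuting⇒common-root fuel x y le eq x≢[] y≢[] with ℕP.≤-total (length x) (length y)
    ... | inj₁ x≤y = common-root-shorter-first fuel x y le x≤y eq x≢[] y≢[]
    ... | inj₂ y≤x with common-root-shorter-first fuel y x (subst (_≤ fuel) (ℕP.+-comm (length x) (length y)) le) y≤x (sym eq) y≢[] x≢[]
    ...   | z , i , j , i≥1 , j≥1 , eqy , eqx = z , j , i , j≥1 , i≥1 , eqx , eqy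

    common-root-shorter-first : ∀ fuel (x y : Word k) → length x + length y ≤ fuel → length x ≤ length y →
      x ++ y ≡ y ++ x → x ≢ [] → y ≢ [] → CommonRoot x y
    common-root-shorter-first zero [] y _ _ _ x≢[] _ = ⊥-elim (x≢[] refl)
    common-root-shorter-first zero (_ ∷ _) y () _ _ _ _
    common-root-shorter-first (suc fuel) x y le x≤y eq x≢[] y≢[] with ++-prefix x y eq x≤y
    ... | [] , refl = x , 1 , 1 , s≤s z≤n , s≤s z≤n , sym (ListP.++-identityʳ x) , trans (ListP.++-identityʳ x) (sym (ListP.++-identityʳ x))
    ... | r@(_ ∷ _) , refl with commuting⇒common-root fuel x r le' eq' x≢[] (λ ())
      where
        eq' : x ++ r ≡ r ++ x
        eq' = ListP.++-cancelˡ x (x ++ r) (r ++ x) (trans eq (ListP.++-assoc x r x))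
        le' : length x + length r ≤ fuel
        le' = ℕP.≤-pred (ℕP.≤-trans (ℕP.≤-trans (ℕP.+-monoˡ-≤ (length x + length r) (nonempty⇒length-pos x≢[]))
                 (ℕP.≤-reflexive (cong (length x +_) (sym (ListP.length-++ x))))) le)
    ... | z , i , j , i≥1 , j≥1 , eqx , eqr =
      z , i , i + j , i≥1 , ℕP.≤-trans j≥1 (ℕP.m≤n+m j i) , eqx , trans (cong₂ _++_ eqx eqr) (sym (pow-+ z i j))

  commuting⇒imprimitive : ∀ (x y : Word k) → x ++ y ≡ y ++ x → x ≢ [] → y ≢ [] → ¬ Primitive (x ++ y)
  commuting⇒imprimitive x y eq x≢[] y≢[] prim
    with commuting⇒common-root (length x + length y) x y ℕP.≤-refl eq x≢[] y≢[]
  ... | z , i , j , i≥1 , j≥1 , eqx , eqy =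
    prim (z , i + j , ℕP.+-mono-≤ i≥1 j≥1 , trans (cong₂ _++_ eqx eqy) (sym (pow-+ z i j)))

  SuffixMinimal : Word k → Set
  SuffixMinimal w = (w ≢ []) × (∀ x y → w ≡ x ++ y → x ≢ [] → y ≢ [] → w <lex y)

  suffixMinimal⇒lyndon : ∀ {w} → SuffixMinimal w → Lyndon w
  suffixMinimal⇒lyndon {w} (w≢[] , smaller) = w≢[] , w-primitive , w-least
    where
      -- w = u^(j+2) would be larger than its proper suffix u^(j+1), one of its prefixes.
      w-primitive : Primitive w
      w-primitive (u , suc (suc j) , s≤s (s≤s z≤n) , refl) with u
      ... | [] = w≢[] (pow-[] (suc (suc j)))
      ... | c ∷ s = lex-asym (smaller (c ∷ s) (pow (c ∷ s) (suc j)) refl (λ ()) (λ ())) suffix<w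
        where
          suffix<w : pow (c ∷ s) (suc j) <lex pow (c ∷ s) (suc (suc j))
          suffix<w = subst (pow (c ∷ s) (suc j) <lex_) (sym (pow-suc (c ∷ s) (suc j))) (lex-proper-prefix (pow (c ∷ s) (suc j)))
      -- w = x y < y, and y is not longer than w, so w < y x.
      w-least : ∀ v → Conjugate w v → v ≢ w → w <lex v
      w-least v ([] , y , refl , refl) v≢w = ⊥-elim (v≢w (ListP.++-identityʳ y))
      w-least v (x@(_ ∷ _) , [] , refl , refl) v≢w = ⊥-elim (v≢w (sym (ListP.++-identityʳ x)))
      w-least v (x@(_ ∷ _) , y@(_ ∷ _) , refl , refl) v≢w =
        subst (_<lex (y ++ x)) (ListP.++-identityʳ (x ++ y))
          (lex-++ [] x (smaller x y refl (λ ()) (λ ())) (ListP.length-++-≤ʳ y {x}))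

  lyndon⇒suffixMinimal : ∀ {w} → Lyndon w → SuffixMinimal w
  lyndon⇒suffixMinimal {w} (w≢[] , w-primitive , w-least) = w≢[] , smaller
    where
      smaller : ∀ x y → w ≡ x ++ y → x ≢ [] → y ≢ [] → w <lex y
      -- If y is not a prefix of w, then y <lex w would be a mismatch, making the
      -- conjugate y x smaller than w.
      smaller x y w≡xy x≢[] y≢[] with prefix? y w
      ... | no ¬pre with lex-trichotomy w y
      ...   | inj₁ w<y = w<y
      ...   | inj₂ (inj₁ refl) = ⊥-elim (¬pre ([] , sym (ListP.++-identityʳ w)))
      ...   | inj₂ (inj₂ y<w) with lex-cases y<w
      ...     | inj₁ (c , s , w≡ys) = ⊥-elim (¬pre (c ∷ s , w≡ys))
      ...     | inj₂ mis = ⊥-elim (lex-asym (w-least (y ++ x) (x , y , w≡xy , refl) yx≢w) yx<w)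
        where
          yx≢w : y ++ x ≢ w
          yx≢w e = ¬pre (x , sym e)
          yx<w : (y ++ x) <lex w
          yx<w = subst ((y ++ x) <lex_) (ListP.++-identityʳ w) (mismatch-++ x [] mis)
      -- If w = y t, then y x ≠ w by primitivity, so y t = w < y x gives t < x and
      -- then the conjugate t y is smaller than x y = w.
      smaller x y w≡xy x≢[] y≢[] | yes (t , w≡yt) with y ++ x ≟ʷ w
      ... | yes yx≡w = ⊥-elim (commuting⇒imprimitive x y (trans (sym w≡xy) (sym yx≡w)) x≢[] y≢[] (subst Primitive w≡xy w-primitive))
      ... | no yx≢w = ⊥-elim (lex-asym (w-least (t ++ y) (y , t , w≡yt , refl) ty≢w) ty<w)
        where
          |t|≡|x| : length t ≡ length x
          |t|≡|x| = ℕP.+-cancelˡ-≡ (length y) (length t) (length x)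
            (trans (sym (ListP.length-++ y)) (trans (cong length (trans (sym w≡yt) w≡xy))
              (trans (ListP.length-++ x) (ℕP.+-comm (length x) (length y)))))
          t<x : t <lex x
          t<x = lex-cancelˡ y (subst (_<lex (y ++ x)) w≡yt (w-least (y ++ x) (x , y , w≡xy , refl) yx≢w))
          ty<w : (t ++ y) <lex w
          ty<w = subst ((t ++ y) <lex_) (sym w≡xy) (lex-++ y y t<x (ℕP.≤-reflexive (sym |t|≡|x|)))
          ty≢w : t ++ y ≢ w
          ty≢w e = lex-irrefl (subst (_<lex w) e ty<w)

  lyndon-conjugates-≡ : ∀ {w v : Word k} → Lyndon w → Lyndon v → Conjugate w v → w ≡ v
  lyndon-conjugates-≡ {w} {v} (_ , _ , w-least) (_ , _ , v-least) (x , y , w≡xy , v≡yx) with v ≟ʷ w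
  ... | yes v≡w = sym v≡w
  ... | no v≢w = ⊥-elim (lex-asym (w-least v (x , y , w≡xy , v≡yx) v≢w) (v-least w (y , x , v≡yx , w≡xy) (λ e → v≢w (sym e))))

-- The standard factorisation

module _ {k : ℕ} where

  Suffix : Word k → Word k → Set
  Suffix s w = Σ (Word k) λ x → w ≡ x ++ s

  suffix-∷ : ∀ {y c s} → Suffix y (c ∷ s) → y ≡ c ∷ s ⊎ Suffix y s
  suffix-∷ ([] , refl) = inj₁ refl
  suffix-∷ (c ∷ x , e) = inj₂ (x , ListP.∷-injectiveʳ e)

  _≤lex_ : Word k → Word k → Set
  u ≤lex v = u ≡ v ⊎ u <lex v

  SmallestSuffix : Word k → Word k → Set
  SmallestSuffix r s = (r ≢ []) × Suffix r s × (∀ y → y ≢ [] → Suffix y s → r ≤lex y)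

  smallest-suffix : ∀ (s : Word k) → s ≢ [] → Σ (Word k) λ r → SmallestSuffix r s
  smallest-suffix [] s≢[] = ⊥-elim (s≢[] refl)
  smallest-suffix (c ∷ []) _ = c ∷ [] , (λ ()) , ([] , refl) , least
    where
      least : ∀ y → y ≢ [] → Suffix y (c ∷ []) → (c ∷ []) ≤lex y
      least y y≢[] suf with suffix-∷ suf
      ... | inj₁ e = inj₁ (sym e)
      ... | inj₂ ([] , e) = ⊥-elim (y≢[] (sym e))
      ... | inj₂ (_ ∷ _ , ())
  -- Compare s itself with the smallest suffix r of its tail.
  smallest-suffix (c ∷ d ∷ s) _ with smallest-suffix (d ∷ s) (λ ())
  ... | r , r≢[] , (x , d∷s≡xr) , r-least with lex-trichotomy (c ∷ d ∷ s) r
  ...   | inj₂ (inj₂ r<s) = r , r≢[] , (c ∷ x , cong (c ∷_) d∷s≡xr) , least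
    where
      least : ∀ y → y ≢ [] → Suffix y (c ∷ d ∷ s) → r ≤lex y
      least y y≢[] suf with suffix-∷ suf
      ... | inj₁ e = inj₂ (subst (r <lex_) (sym e) r<s)
      ... | inj₂ suf' = r-least y y≢[] suf'
  ...   | inj₂ (inj₁ s≡r) = ⊥-elim (≢-by-length (length-++-<ʳ (c ∷ x) r (λ ())) (trans (sym s≡r) (cong (c ∷_) d∷s≡xr)))
  ...   | inj₁ s<r = c ∷ d ∷ s , (λ ()) , ([] , refl) , least
    where
      least : ∀ y → y ≢ [] → Suffix y (c ∷ d ∷ s) → (c ∷ d ∷ s) ≤lex y
      least y y≢[] suf with suffix-∷ suf
      ... | inj₁ e = inj₁ (sym e)
      ... | inj₂ suf' with r-least y y≢[] suf'
      ...   | inj₁ refl = inj₂ s<r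
      ...   | inj₂ r<y = inj₂ (lex-trans s<r r<y)

  -- Every Lyndon word c s of length ≥ 2 is u v with u, v Lyndon, where v is the
  -- smallest proper suffix.
  standard-factorisation : ∀ c (s : Word k) → s ≢ [] → SuffixMinimal (c ∷ s) →
    Σ (Word k) λ u → Σ (Word k) λ v → (c ∷ s ≡ u ++ v) × SuffixMinimal u × SuffixMinimal v
  standard-factorisation c s s≢[] (_ , w-smaller) with smallest-suffix s s≢[]
  ... | v , v≢[] , (x , refl) , v-least = c ∷ x , v , refl , ((λ ()) , u-smaller) , (v≢[] , v-smaller)
    where
      w<qv : ∀ p q → c ∷ x ≡ p ++ q → p ≢ [] → q ≢ [] → (c ∷ x ++ v) <lex (q ++ v)
      w<qv p q u≡pq p≢[] q≢[] =
        w-smaller p (q ++ v) (trans (cong (_++ v) u≡pq) (ListP.++-assoc p q v)) p≢[] (λ e → q≢[] (ListP.++-conicalˡ q v e))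

      -- A proper suffix of v is a shorter suffix of s.
      v-smaller : ∀ p q → v ≡ p ++ q → p ≢ [] → q ≢ [] → v <lex q
      v-smaller p q refl p≢[] q≢[] with v-least q q≢[] (x ++ p , sym (ListP.++-assoc x p q))
      ... | inj₁ e = ⊥-elim (≢-by-length (length-++-<ʳ p q p≢[]) (sym e))
      ... | inj₂ lt = lt

      u-smaller : ∀ p q → c ∷ x ≡ p ++ q → p ≢ [] → q ≢ [] → (c ∷ x) <lex q
      -- If u = q t, then w < q v forces t v < v, against the minimality of v.
      u-smaller p q u≡pq p≢[] q≢[] with prefix? q (c ∷ x)
      ... | yes (t , u≡qt) = ⊥-elim (lex-asym tv<v (v≤tv (v-least (t ++ v) (λ e → v≢[] (ListP.++-conicalʳ t v e)) tv-suffix)))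
        where
          tv<v : (t ++ v) <lex v
          tv<v = lex-cancelˡ q (subst (_<lex (q ++ v)) (trans (cong (_++ v) u≡qt) (ListP.++-assoc q t v)) (w<qv p q u≡pq p≢[] q≢[]))
          t≢[] : t ≢ []
          t≢[] refl = ≢-by-length (length-++-<ʳ p q p≢[]) (sym (trans (sym u≡pq) (trans u≡qt (ListP.++-identityʳ q))))
          tv-suffix : Suffix (t ++ v) (x ++ v)
          tv-suffix = drop-head q q≢[] u≡qt
            where
              drop-head : ∀ q' → q' ≢ [] → c ∷ x ≡ q' ++ t → Suffix (t ++ v) (x ++ v)
              drop-head [] q'≢[] _ = ⊥-elim (q'≢[] refl)
              drop-head (_ ∷ q'') _ e = q'' , trans (cong (_++ v) (ListP.∷-injectiveʳ e)) (ListP.++-assoc q'' t v)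
          v≤tv : v ≤lex (t ++ v) → v <lex (t ++ v)
          v≤tv (inj₁ e) = ⊥-elim (≢-by-length (length-++-<ʳ t v t≢[]) e)
          v≤tv (inj₂ lt) = lt
      -- Otherwise q <lex u could only be a mismatch, giving q v < u v = w.
      ... | no ¬pre with lex-trichotomy (c ∷ x) q
      ...   | inj₁ u<q = u<q
      ...   | inj₂ (inj₁ e) = ⊥-elim (¬pre ([] , trans e (sym (ListP.++-identityʳ q))))
      ...   | inj₂ (inj₂ q<u) with lex-cases q<u
      ...     | inj₁ (d , r , e) = ⊥-elim (¬pre (d ∷ r , e))
      ...     | inj₂ mis = ⊥-elim (lex-asym (mismatch-++ v v mis) (w<qv p q u≡pq p≢[] q≢[]))

module _ {X : Set} {P : X → Set} (P? : Decidable P) where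

  filter-length-∷ : ∀ x (xs : List X) → length (filter P? (x ∷ xs)) ≤ suc (length (filter P? xs))
  filter-length-∷ x xs with P? x
  ... | yes _ = ℕP.≤-refl
  ... | no _ = ℕP.n≤1+n _

  filter-drops-one : ∀ {x} {xs : List X} → x ∈ xs → ¬ P x → 1 + length (filter P? xs) ≤ length xs
  filter-drops-one {xs = xs} x∈xs ¬Px = ListP.filter-notAll P? xs (Any.map (λ { refl → ¬Px }) x∈xs)

  filter-drops-two : ∀ {x y} {xs : List X} → x ∈ xs → y ∈ xs → x ≢ y → ¬ P x → ¬ P y → 2 + length (filter P? xs) ≤ length xs
  filter-drops-two (here refl) (here refl) x≢y _ _ = ⊥-elim (x≢y refl)
  filter-drops-two {xs = z ∷ zs} (here refl) (there y∈zs) _ ¬Px ¬Py with P? z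
  ... | yes Pz = ⊥-elim (¬Px Pz)
  ... | no _ = s≤s (filter-drops-one y∈zs ¬Py)
  filter-drops-two {xs = z ∷ zs} (there x∈zs) (here refl) _ ¬Px ¬Py with P? z
  ... | yes Pz = ⊥-elim (¬Py Pz)
  ... | no _ = s≤s (filter-drops-one x∈zs ¬Px)
  filter-drops-two {xs = z ∷ zs} (there x∈zs) (there y∈zs) x≢y ¬Px ¬Py =
    ℕP.≤-trans (s≤s (s≤s (filter-length-∷ z zs))) (s≤s (filter-drops-two x∈zs y∈zs x≢y ¬Px ¬Py))

unique-⊆⇒length-≤ : ∀ {X : Set} → DecidableEquality X → (xs ys : List X) → Unique xs →
  (∀ z → z ∈ xs → z ∈ ys) → length xs ≤ length ys
unique-⊆⇒length-≤ _≟_ [] ys _ _ = z≤n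
unique-⊆⇒length-≤ _≟_ (x ∷ xs) ys (x∉xs ∷ unique) xs⊆ys =
  ℕP.≤-trans (s≤s (unique-⊆⇒length-≤ _≟_ xs (filter ≢x? ys) unique xs⊆ys-x)) (filter-drops-one ≢x? (xs⊆ys x (here refl)) (λ x≢x → x≢x refl))
  where
    ≢x? = λ z → ¬? (x ≟ z)
    xs⊆ys-x : ∀ z → z ∈ xs → z ∈ filter ≢x? ys
    xs⊆ys-x z z∈xs = ∈P.∈-filter⁺ ≢x? (xs⊆ys z (there z∈xs)) (lookup x∉xs z∈xs)

fib-pos : ∀ n → 1 ≤ n → 1 ≤ fib n
fib-pos (suc zero) _ = s≤s z≤n
fib-pos (suc (suc n)) _ = ℕP.≤-trans (fib-pos (suc n) (s≤s z≤n)) (ℕP.m≤m+n (fib (suc n)) (fib n))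

fib-mono : ∀ {m n} → m ≤ n → fib m ≤ fib n
fib-mono {m} {n} m≤n with ℕP.m≤n⇒∃[o]m+o≡n m≤n
... | o , refl = go m o
  where
    step : ∀ n → fib n ≤ fib (suc n)
    step zero = z≤n
    step (suc n) = ℕP.m≤m+n (fib (suc n)) (fib n)
    go : ∀ m o → fib m ≤ fib (m + o)
    go m zero rewrite ℕP.+-identityʳ m = ℕP.≤-refl
    go m (suc o) rewrite ℕP.+-suc m o = ℕP.≤-trans (go m o) (step (m + o))

-- From F_3 on, the sequence is strictly increasing, so fib reflects ≤ there.
fib-reflects-≤ : ∀ {m n} → 3 ≤ m → fib m ≤ fib n → m ≤ n
fib-reflects-≤ {m} {n} 3≤m fm≤fn with m ℕP.≤? n
... | yes m≤n = m≤n
... | no m≰n = ⊥-elim (ℕP.<-irrefl refl (ℕP.≤-trans (strict m n 3≤m (ℕP.≰⇒> m≰n)) fm≤fn))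
  where
    strict : ∀ m n → 3 ≤ m → n < m → fib n < fib m
    strict (suc (suc (suc p))) n (s≤s (s≤s (s≤s z≤n))) (s≤s n≤p+2) =
      ℕP.≤-trans (s≤s (fib-mono n≤p+2))
        (subst (_≤ fib (suc (suc p)) + fib (suc p)) (ℕP.+-comm (fib (suc (suc p))) 1)
          (ℕP.+-monoʳ-≤ (fib (suc (suc p))) (fib-pos (suc p) (s≤s z≤n))))

fib-+-≤ : ∀ L a b → 2 + a ≤ L → 1 + b ≤ L → fib a + fib b ≤ fib L
fib-+-≤ (suc (suc L)) a b (s≤s (s≤s a≤L)) (s≤s b≤L+1) =
  subst (fib a + fib b ≤_) (ℕP.+-comm (fib L) (fib (suc L))) (ℕP.+-mono-≤ (fib-mono a≤L) (fib-mono b≤L+1))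

-- The lower bound |w| ≤ F(number of Lyndon factors)

module _ {k : ℕ} where

  Covers : List (Word k) → Word k → Set
  Covers ls w = ∀ z → Factor z w → Lyndon z → z ∈ ls

  restrict : Word k → List (Word k) → List (Word k)
  restrict u = filter (λ z → factor? z u)

  covers-restrict : ∀ {ls w u} → Covers ls w → Factor u w → Covers (restrict u ls) u
  covers-restrict {u = u} covers u⊑w z z⊑u lyn = ∈P.∈-filter⁺ (λ z → factor? z u) (covers z (factor-trans z⊑u u⊑w) lyn) z⊑u

  data Product (w u v : Word k) : Set where
    in-order : w ≡ u ++ v → Product w u v
    swapped : w ≡ v ++ u → Product w u v

  product-factors : ∀ {w u v} → Product w u v → Factor u w × Factor v w
  product-factors {u = u} {v} (in-order refl) = factor-++ˡ u v , factor-++ʳ u v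
  product-factors {u = u} {v} (swapped refl) = factor-++ʳ v u , factor-++ˡ v u

  product-length : ∀ {w u v} → Product w u v → length u + length v ≡ length w
  product-length {u = u} {v} (in-order refl) = sym (ListP.length-++ u)
  product-length {u = u} {v} (swapped refl) = trans (ℕP.+-comm (length u) (length v)) (sym (ListP.length-++ v))

  product-swap : ∀ {w u v} → Product w u v → Product w v u
  product-swap (in-order e) = swapped e
  product-swap (swapped e) = in-order e

  product-< : ∀ {w u v} → Product w u v → v ≢ [] → length u < length w
  product-< {u = u} {v} (in-order refl) v≢[] = length-++-< u v v≢[]
  product-< {u = u} {v} (swapped refl) v≢[] = length-++-<ʳ v u v≢[]

  record Split (w : Word k) (ls : List (Word k)) : Set where
    field
      u v : Word k
      product : Product w u v
      u-minimal : SuffixMinimal u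
      v-minimal : SuffixMinimal v
      u-count : 2 + length (restrict u ls) ≤ length ls
      v-count : 1 + length (restrict v ls) ≤ length ls

  -- Use the standard factorisation w = x y.  The restrictions lose w itself; the
  -- restriction to y also loses x unless x is a factor of y, and vice versa; if
  -- both were factors of each other, w = x x would not be primitive.
  lyndon-split : ∀ c (s : Word k) ls → s ≢ [] → SuffixMinimal (c ∷ s) → Covers ls (c ∷ s) → Split (c ∷ s) ls
  lyndon-split c s ls s≢[] w-min covers with standard-factorisation c s s≢[] w-min
  ... | x , y , w≡xy , x-min , y-min = split
    where
      w = c ∷ s
      w∈ls : w ∈ ls
      w∈ls = covers w (factor-refl w) (suffixMinimal⇒lyndon w-min)
      x-shorter : length x < length w
      x-shorter = product-< (in-order w≡xy) (proj₁ y-min)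
      y-shorter : length y < length w
      y-shorter = product-< (swapped w≡xy) (proj₁ x-min)
      w⋢ : ∀ {z} → length z < length w → ¬ Factor w z
      w⋢ shorter w⊑z = ℕP.<-irrefl refl (ℕP.≤-trans shorter (factor-length w⊑z))
      split : Split w ls
      split with factor? x y
      ... | no x⋢y = record
        { u = y ; v = x ; product = swapped w≡xy ; u-minimal = y-min ; v-minimal = x-min
        ; u-count = filter-drops-two (λ z → factor? z y) w∈ls
                      (covers x (proj₁ (product-factors (in-order w≡xy))) (suffixMinimal⇒lyndon x-min))
                      (λ e → ≢-by-length x-shorter (sym e)) (w⋢ y-shorter) x⋢y
        ; v-count = filter-drops-one (λ z → factor? z x) w∈ls (w⋢ x-shorter) }
      ... | yes x⊑y with factor? y x
      ...   | no y⋢x = record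
        { u = x ; v = y ; product = in-order w≡xy ; u-minimal = x-min ; v-minimal = y-min
        ; u-count = filter-drops-two (λ z → factor? z x) w∈ls
                      (covers y (proj₂ (product-factors (in-order w≡xy))) (suffixMinimal⇒lyndon y-min))
                      (λ e → ≢-by-length y-shorter (sym e)) (w⋢ x-shorter) y⋢x
        ; v-count = filter-drops-one (λ z → factor? z y) w∈ls (w⋢ y-shorter) }
      ...   | yes y⊑x = ⊥-elim (proj₁ (proj₂ (suffixMinimal⇒lyndon w-min)) (x , 2 , s≤s (s≤s z≤n) , w≡xx))
        where
          x≡y : x ≡ y
          x≡y = factor-length-≡ x⊑y (ℕP.≤-antisym (factor-length x⊑y) (factor-length y⊑x))
          w≡xx : w ≡ pow x 2
          w≡xx = trans w≡xy (cong (x ++_) (trans (sym x≡y) (sym (ListP.++-identityʳ x))))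

  ∈⇒length-pos : ∀ {z} {zs : List (Word k)} → z ∈ zs → 1 ≤ length zs
  ∈⇒length-pos {zs = _ ∷ _} _ = s≤s z≤n

  length-≤-fib-cover : ∀ fuel (w : Word k) → length w ≤ fuel → SuffixMinimal w →
    ∀ ls → Covers ls w → length w ≤ fib (length ls)
  length-≤-fib-cover fuel [] _ (w≢[] , _) _ _ = ⊥-elim (w≢[] refl)
  length-≤-fib-cover fuel (c ∷ []) _ w-min ls covers =
    fib-pos (length ls) (∈⇒length-pos (covers (c ∷ []) (factor-refl (c ∷ [])) (suffixMinimal⇒lyndon w-min)))
  length-≤-fib-cover (suc fuel) (c ∷ d ∷ s) (s≤s |w|≤fuel) w-min ls covers = begin
    length (c ∷ d ∷ s)                                    ≡⟨ sym (product-length product) ⟩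
    length u + length v                                   ≤⟨ ℕP.+-mono-≤ u-bound v-bound ⟩
    fib (length (restrict u ls)) + fib (length (restrict v ls)) ≤⟨ fib-+-≤ (length ls) _ _ u-count v-count ⟩
    fib (length ls)                                       ∎
    where
      open ℕP.≤-Reasoning
      open Split (lyndon-split c (d ∷ s) ls (λ ()) w-min covers)
      u-bound : length u ≤ fib (length (restrict u ls))
      u-bound = length-≤-fib-cover fuel u (ℕP.≤-trans (ℕP.≤-pred (product-< product (proj₁ v-minimal))) |w|≤fuel)
                  u-minimal (restrict u ls) (covers-restrict covers (proj₁ (product-factors product)))
      v-bound : length v ≤ fib (length (restrict v ls))
      v-bound = length-≤-fib-cover fuel v (ℕP.≤-trans (ℕP.≤-pred (product-< (product-swap product) (proj₁ u-minimal))) |w|≤fuel)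
                  v-minimal (restrict v ls) (covers-restrict covers (proj₂ (product-factors product)))

-- Binary words and block morphisms

Binary : Set
Binary = Word 2

pattern 𝚊 = zero
pattern 𝚋 = suc zero

infixr 25 _⋆_
_⋆_ : (Fin 2 → Binary) → Binary → Binary
f ⋆ x = concatMap f x

⋆-++ : ∀ f (x y : Binary) → f ⋆ (x ++ y) ≡ f ⋆ x ++ f ⋆ y
⋆-++ f x y = trans (cong concat (ListP.map-++ f x y)) (sym (ListP.concat-++ (map f x) (map f y)))

Block : (Fin 2 → Binary) → Set
Block f = ∀ c → (Σ (Fin 2) λ e → f c ≡ e ∷ []) ⊎ f c ≡ 𝚊 ∷ 𝚋 ∷ []

-- Words beginning with 𝚊, resp. ending with 𝚋: the possible borders of blocks.
StartsWith𝚊 : Binary → Set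
StartsWith𝚊 t = Σ Binary λ t' → t ≡ 𝚊 ∷ t'

EndsWith𝚋 : Binary → Set
EndsWith𝚋 z = Σ Binary λ z' → z ≡ z' ++ 𝚋 ∷ []

endsWith𝚋-≢[] : ∀ {z} → EndsWith𝚋 z → z ≢ []
endsWith𝚋-≢[] ([] , ()) refl
endsWith𝚋-≢[] (_ ∷ _ , ()) refl

endsWith𝚋-tail : ∀ {c} {r} → EndsWith𝚋 (c ∷ r) → r ≢ [] → EndsWith𝚋 r
endsWith𝚋-tail ([] , refl) r≢[] = ⊥-elim (r≢[] refl)
endsWith𝚋-tail (_ ∷ z' , e) _ = z' , ListP.∷-injectiveʳ e

module Desubstitution (f : Fin 2 → Binary) (block : Block f) where

  block-≢[] : ∀ c → f c ≢ []
  block-≢[] c e with block c | e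
  ... | inj₁ (_ , fc≡e) | fc≡[] with () ← trans (sym fc≡e) fc≡[]
  ... | inj₂ fc≡ab | fc≡[] with () ← trans (sym fc≡ab) fc≡[]

  ⋆-≢[] : ∀ x → x ≢ [] → f ⋆ x ≢ []
  ⋆-≢[] [] x≢[] _ = x≢[] refl
  ⋆-≢[] (c ∷ x) _ e = block-≢[] c (ListP.++-conicalˡ (f c) (f ⋆ x) e)

  cut-before-𝚊 : ∀ x p t → f ⋆ x ≡ p ++ t → StartsWith𝚊 t →
    Σ Binary λ x₁ → Σ Binary λ x₂ → (x ≡ x₁ ++ x₂) × (f ⋆ x₂ ≡ t)
  cut-before-𝚊 x [] t eq _ = [] , x , refl , eq
  cut-before-𝚊 [] (_ ∷ _) t () _
  cut-before-𝚊 (c ∷ x) (q ∷ p) t eq starts with block c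
  ... | inj₁ (e , fc≡e) with cut-before-𝚊 x p t (ListP.∷-injectiveʳ (trans (cong (_++ f ⋆ x) (sym fc≡e)) eq)) starts
  ...   | x₁ , x₂ , refl , e₂ = c ∷ x₁ , x₂ , refl , e₂
  cut-before-𝚊 (c ∷ x) (q ∷ p) t eq starts | inj₂ fc≡ab = inside-ab p (ListP.∷-injectiveʳ (trans (cong (_++ f ⋆ x) (sym fc≡ab)) eq))
    where
      inside-ab : ∀ p → 𝚋 ∷ f ⋆ x ≡ p ++ t → Σ Binary λ x₁ → Σ Binary λ x₂ → (c ∷ x ≡ x₁ ++ x₂) × (f ⋆ x₂ ≡ t)
      inside-ab [] eq' with () ← trans eq' (proj₂ starts)
      inside-ab (_ ∷ p') eq' with cut-before-𝚊 x p' t (ListP.∷-injectiveʳ eq') starts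
      ... | x₁ , x₂ , refl , e₂ = c ∷ x₁ , x₂ , refl , e₂

  cut-after-𝚋 : ∀ x z s → f ⋆ x ≡ z ++ s → EndsWith𝚋 z →
    Σ Binary λ x₁ → Σ Binary λ x₂ → (x ≡ x₁ ++ x₂) × (f ⋆ x₁ ≡ z)
  cut-after-𝚋 [] z s eq ends = ⊥-elim (endsWith𝚋-≢[] ends (ListP.++-conicalˡ z s (sym eq)))
  cut-after-𝚋 (c ∷ x) z s eq ends with block c
  ... | inj₁ (e , fc≡e) = after-letter z (trans (cong (_++ f ⋆ x) (sym fc≡e)) eq) ends
    where
      after-letter : ∀ z → e ∷ f ⋆ x ≡ z ++ s → EndsWith𝚋 z →
        Σ Binary λ x₁ → Σ Binary λ x₂ → (c ∷ x ≡ x₁ ++ x₂) × (f ⋆ x₁ ≡ z)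
      after-letter [] _ ends' = ⊥-elim (endsWith𝚋-≢[] ends' refl)
      after-letter (_ ∷ []) eq' _ = c ∷ [] , x , refl , trans (ListP.++-identityʳ (f c)) (trans fc≡e (cong (_∷ []) (ListP.∷-injectiveˡ eq')))
      after-letter (z₀ ∷ z@(_ ∷ _)) eq' ends' with cut-after-𝚋 x z s (ListP.∷-injectiveʳ eq') (endsWith𝚋-tail ends' (λ ()))
      ... | x₁ , x₂ , refl , e₂ = c ∷ x₁ , x₂ , refl , trans (cong₂ _++_ fc≡e e₂) (cong (_∷ z) (ListP.∷-injectiveˡ eq'))
  ... | inj₂ fc≡ab = after-ab z (trans (cong (_++ f ⋆ x) (sym fc≡ab)) eq) ends
    where
      after-ab : ∀ z → 𝚊 ∷ 𝚋 ∷ f ⋆ x ≡ z ++ s → EndsWith𝚋 z →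
        Σ Binary λ x₁ → Σ Binary λ x₂ → (c ∷ x ≡ x₁ ++ x₂) × (f ⋆ x₁ ≡ z)
      after-ab [] _ ends' = ⊥-elim (endsWith𝚋-≢[] ends' refl)
      after-ab (_ ∷ []) refl ([] , ())
      after-ab (_ ∷ []) refl (_ ∷ [] , ())
      after-ab (_ ∷ []) refl (_ ∷ _ ∷ _ , ())
      after-ab (_ ∷ _ ∷ []) refl _ = c ∷ [] , x , refl , trans (ListP.++-identityʳ (f c)) fc≡ab
      after-ab (z₀ ∷ z₁ ∷ z@(_ ∷ _)) eq' ends'
        with ListP.∷-injective eq' | cut-after-𝚋 x z s (ListP.∷-injectiveʳ (ListP.∷-injectiveʳ eq')) (endsWith𝚋-tail (endsWith𝚋-tail ends' (λ ())) (λ ()))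
      ... | refl , eq'' | x₁ , x₂ , refl , e₂ with ListP.∷-injectiveˡ eq''
      ...   | refl = c ∷ x₁ , x₂ , refl , cong₂ _++_ fc≡ab e₂

  desubstitute : ∀ {z x} → Factor z (f ⋆ x) → StartsWith𝚊 z → EndsWith𝚋 z →
    Σ Binary λ z' → Factor z' x × (f ⋆ z' ≡ z)
  desubstitute {z} {x} (p , s , eq) (z₁ , refl) ends with cut-before-𝚊 x p (z ++ s) eq (z₁ ++ s , refl)
  ... | x₁ , x' , refl , e₂ with cut-after-𝚋 x' z s e₂ ends
  ...   | x₂ , x₃ , refl , e₄ = x₂ , (x₁ , x₃ , refl) , e₄

𝚋-maximal : ∀ (r : Binary) → ¬ ((𝚋 ∷ r) <lex r)
𝚋-maximal [] ()
𝚋-maximal (𝚊 ∷ r) (here ())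
𝚋-maximal (𝚋 ∷ r) (here (s≤s ()))
𝚋-maximal (𝚋 ∷ r) (there q) = 𝚋-maximal r q

lyndon-starts-with-𝚊 : ∀ {c d} {r : Binary} → SuffixMinimal (c ∷ d ∷ r) → c ≡ 𝚊
lyndon-starts-with-𝚊 {𝚊} _ = refl
lyndon-starts-with-𝚊 {𝚋} {d} {r} (_ , smaller) = ⊥-elim (𝚋-maximal (d ∷ r) (smaller (𝚋 ∷ []) (d ∷ r) refl (λ ()) (λ ())))

lyndon-ends-with-𝚋 : ∀ (w : Binary) → SuffixMinimal w → 2 ≤ length w → EndsWith𝚋 w
lyndon-ends-with-𝚋 w w-min len with initLast w
lyndon-ends-with-𝚋 .[] _ () | []
lyndon-ends-with-𝚋 .(i ∷ʳ 𝚋) _ _ | i ∷ʳ′ 𝚋 = i , refl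
lyndon-ends-with-𝚋 .([] ∷ʳ 𝚊) _ (s≤s ()) | [] ∷ʳ′ 𝚊
lyndon-ends-with-𝚋 .((c ∷ i) ∷ʳ 𝚊) (_ , smaller) _ | (c ∷ i) ∷ʳ′ 𝚊
  with smaller (c ∷ i) (𝚊 ∷ []) refl (λ ()) (λ ())
... | here ()
... | there ()

module Substitution (f : Fin 2 → Binary) (block : Block f)
                    (mono : ∀ {x y : Binary} → x <lex y → f ⋆ x <lex f ⋆ y) where
  open Desubstitution f block

  -- A monotone morphism reflects the Lyndon property: a suffix y of z with
  -- y ≤ z would give the suffix f ⋆ y ≤ f ⋆ z.
  reflects-lyndon : ∀ z → SuffixMinimal (f ⋆ z) → SuffixMinimal z
  reflects-lyndon z (fz≢[] , smaller) = (λ e → fz≢[] (cong (f ⋆_) e)) , z-smaller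
    where
      z-smaller : ∀ x y → z ≡ x ++ y → x ≢ [] → y ≢ [] → z <lex y
      z-smaller x y refl x≢[] y≢[] with lex-trichotomy (x ++ y) y
      ... | inj₁ lt = lt
      ... | inj₂ (inj₁ e) = ⊥-elim (≢-by-length (length-++-<ʳ x y x≢[]) (sym e))
      ... | inj₂ (inj₂ gt) = ⊥-elim (lex-asym (mono gt) (smaller (f ⋆ x) (f ⋆ y) (⋆-++ f x y) (⋆-≢[] x x≢[]) (⋆-≢[] y y≢[])))

  -- Suffixes starting with 𝚊 are images of
  -- suffixes by desubstitution; suffixes starting with 𝚋 are larger anyway.
  preserves-lyndon : (∀ z → SuffixMinimal z → StartsWith𝚊 (f ⋆ z) ⊎ f ⋆ z ≡ 𝚋 ∷ []) →
    ∀ z → SuffixMinimal z → SuffixMinimal (f ⋆ z)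
  preserves-lyndon head z z-min@(z≢[] , smaller) = ⋆-≢[] z z≢[] , fz-smaller
    where
      fz-smaller : ∀ p t → f ⋆ z ≡ p ++ t → p ≢ [] → t ≢ [] → f ⋆ z <lex t
      fz-smaller p [] _ _ t≢[] = ⊥-elim (t≢[] refl)
      fz-smaller p (𝚊 ∷ t') eq p≢[] _ with cut-before-𝚊 z p (𝚊 ∷ t') eq (t' , refl)
      ... | x₁ , x₂ , refl , fx₂≡t = subst (f ⋆ (x₁ ++ x₂) <lex_) fx₂≡t (mono (smaller x₁ x₂ refl x₁≢[] x₂≢[]))
        where
          x₂≢[] : x₂ ≢ []
          x₂≢[] e with () ← trans (cong (f ⋆_) (sym e)) fx₂≡t
          fx₁≡p : f ⋆ x₁ ≡ p
          fx₁≡p = ListP.++-cancelʳ (𝚊 ∷ t') (f ⋆ x₁) p (trans (trans (cong (f ⋆ x₁ ++_) (sym fx₂≡t)) (sym (⋆-++ f x₁ x₂))) eq)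
          x₁≢[] : x₁ ≢ []
          x₁≢[] refl = p≢[] (sym fx₁≡p)
      fz-smaller p (𝚋 ∷ t') eq p≢[] _ with head z z-min
      ... | inj₁ (q , e) = subst (_<lex (𝚋 ∷ t')) (sym e) (here (s≤s z≤n))
      ... | inj₂ e = ⊥-elim (single p (trans (sym eq) e) p≢[])
        where
          single : ∀ p → p ++ 𝚋 ∷ t' ≡ 𝚋 ∷ [] → p ≢ [] → ⊥
          single [] _ p≢[] = p≢[] refl
          single (_ ∷ []) () _
          single (_ ∷ _ ∷ _) () _

-- The Fibonacci Lyndon words over {𝚊 < 𝚋}

σ : Bool → Fin 2 → Binary
σ true 𝚊 = 𝚊 ∷ []
σ true 𝚋 = 𝚊 ∷ 𝚋 ∷ []
σ false 𝚊 = 𝚊 ∷ 𝚋 ∷ []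
σ false 𝚋 = 𝚋 ∷ []

-- Applying σ true and σ false alternately to 𝚊𝚋 yields the two Fibonacci Lyndon
-- words of length F_{i+3}: fibLyndon true i = 𝚊 p 𝚋, fibLyndon false i = 𝚊 c(p) 𝚋.
fibLyndon : Bool → ℕ → Binary
fibLyndon t zero = 𝚊 ∷ 𝚋 ∷ []
fibLyndon t (suc i) = σ t ⋆ fibLyndon (not t) i

σ-block : ∀ t → Block (σ t)
σ-block true 𝚊 = inj₁ (𝚊 , refl)
σ-block true 𝚋 = inj₂ refl
σ-block false 𝚊 = inj₂ refl
σ-block false 𝚋 = inj₁ (𝚋 , refl)

σ-mono : ∀ t {x y : Binary} → x <lex y → σ t ⋆ x <lex σ t ⋆ y
σ-mono true (prefix {𝚊}) = prefix
σ-mono true (prefix {𝚋}) = prefix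
σ-mono false (prefix {𝚊}) = prefix
σ-mono false (prefix {𝚋}) = prefix
σ-mono t (here {𝚊} {𝚊} ())
σ-mono t (here {𝚋} {𝚊} ())
σ-mono t (here {𝚋} {𝚋} (s≤s ()))
σ-mono true (here {𝚊} {𝚋} {xs} {ys} _) = there (below-𝚋 xs)
  where
    below-𝚋 : ∀ xs → σ true ⋆ xs <lex (𝚋 ∷ σ true ⋆ ys)
    below-𝚋 [] = prefix
    below-𝚋 (𝚊 ∷ _) = here (s≤s z≤n)
    below-𝚋 (𝚋 ∷ _) = here (s≤s z≤n)
σ-mono false (here {𝚊} {𝚋} _) = here (s≤s z≤n)
σ-mono true (there {𝚊} q) = there (σ-mono true q)
σ-mono true (there {𝚋} q) = there (there (σ-mono true q))
σ-mono false (there {𝚊} q) = there (there (σ-mono false q))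
σ-mono false (there {𝚋} q) = there (σ-mono false q)

σ-head : ∀ t z → SuffixMinimal z → StartsWith𝚊 (σ t ⋆ z) ⊎ σ t ⋆ z ≡ 𝚋 ∷ []
σ-head t [] (z≢[] , _) = ⊥-elim (z≢[] refl)
σ-head true (𝚊 ∷ []) _ = inj₁ (_ , refl)
σ-head true (𝚋 ∷ []) _ = inj₁ (_ , refl)
σ-head false (𝚊 ∷ []) _ = inj₁ (_ , refl)
σ-head false (𝚋 ∷ []) _ = inj₂ refl
σ-head true (𝚊 ∷ _ ∷ _) _ = inj₁ (_ , refl)
σ-head false (𝚊 ∷ _ ∷ _) _ = inj₁ (_ , refl)
σ-head t (𝚋 ∷ _ ∷ _) z-min with () ← lyndon-starts-with-𝚊 z-min

module σ-Substitution (t : Bool) = Substitution (σ t) (σ-block t) (σ-mono t)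

𝚊𝚋-minimal : SuffixMinimal {2} (𝚊 ∷ 𝚋 ∷ [])
𝚊𝚋-minimal = (λ ()) , smaller
  where
    smaller : ∀ (x y : Binary) → 𝚊 ∷ 𝚋 ∷ [] ≡ x ++ y → x ≢ [] → y ≢ [] → (𝚊 ∷ 𝚋 ∷ []) <lex y
    smaller [] _ _ x≢[] _ = ⊥-elim (x≢[] refl)
    smaller (_ ∷ []) (_ ∷ []) refl _ _ = here (s≤s z≤n)
    smaller (_ ∷ []) [] _ _ y≢[] = ⊥-elim (y≢[] refl)
    smaller (_ ∷ _ ∷ []) [] _ _ y≢[] = ⊥-elim (y≢[] refl)
    smaller (_ ∷ _ ∷ []) (_ ∷ _) () _ _
    smaller (_ ∷ []) (_ ∷ _ ∷ _) () _ _
    smaller (_ ∷ _ ∷ _ ∷ _) _ () _ _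

fibLyndon-minimal : ∀ t i → SuffixMinimal (fibLyndon t i)
fibLyndon-minimal t zero = 𝚊𝚋-minimal
fibLyndon-minimal t (suc i) = σ-Substitution.preserves-lyndon t (σ-head t) (fibLyndon (not t) i) (fibLyndon-minimal (not t) i)

fibLyndon-product : ∀ t i → Product (fibLyndon t (2 + i)) (fibLyndon t (1 + i)) (fibLyndon t i)
fibLyndon-product true zero = in-order refl
fibLyndon-product false zero = swapped refl
fibLyndon-product t (suc i) with fibLyndon-product (not t) i
... | in-order e = in-order (trans (cong (σ t ⋆_) e) (⋆-++ (σ t) (fibLyndon (not t) (1 + i)) (fibLyndon (not t) i)))
... | swapped e = swapped (trans (cong (σ t ⋆_) e) (⋆-++ (σ t) (fibLyndon (not t) i) (fibLyndon (not t) (1 + i))))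

fibLyndon-borders : ∀ t i → Σ Binary λ r → fibLyndon t i ≡ 𝚊 ∷ r ++ 𝚋 ∷ []
fibLyndon-borders t zero = [] , refl
fibLyndon-borders true (suc i) with fibLyndon-borders false i
... | r , e = σ true ⋆ r ++ 𝚊 ∷ [] , trans (cong (σ true ⋆_) e)
  (cong (𝚊 ∷_) (trans (⋆-++ (σ true) r (𝚋 ∷ [])) (sym (ListP.++-assoc (σ true ⋆ r) (𝚊 ∷ []) (𝚋 ∷ [])))))
fibLyndon-borders false (suc i) with fibLyndon-borders true i
... | r , e = 𝚋 ∷ σ false ⋆ r , trans (cong (σ false ⋆_) e) (cong (λ x → 𝚊 ∷ 𝚋 ∷ x) (⋆-++ (σ false) r (𝚋 ∷ [])))

fibLyndon-letters : ∀ t i → (𝚊 ∈ fibLyndon t i) × (𝚋 ∈ fibLyndon t i)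
fibLyndon-letters t i with fibLyndon-borders t i
... | r , e rewrite e = here refl , there (∈P.∈-++⁺ʳ r (here refl))

Listed : Bool → ℕ → Binary → Set
Listed t i z = (Σ (Fin 2) λ c → z ≡ c ∷ []) ⊎ (Σ ℕ λ j → j ≤ i × z ≡ fibLyndon t j)

listing : Bool → ℕ → List Binary
listing t i = (𝚊 ∷ []) ∷ (𝚋 ∷ []) ∷ applyUpTo (fibLyndon t) (suc i)

listing-length : ∀ t i → length (listing t i) ≡ 3 + i
listing-length t i = cong (λ n → 2 + n) (ListP.length-applyUpTo (fibLyndon t) (suc i))

listed⇒∈ : ∀ t i z → Listed t i z → z ∈ listing t i
listed⇒∈ t i _ (inj₁ (𝚊 , refl)) = here refl
listed⇒∈ t i _ (inj₁ (𝚋 , refl)) = there (here refl)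
listed⇒∈ t i _ (inj₂ (j , j≤i , refl)) = there (there (∈P.∈-applyUpTo⁺ (fibLyndon t) (s≤s j≤i)))

factors-of-𝚊𝚋 : ∀ t (z : Binary) → Factor z (𝚊 ∷ 𝚋 ∷ []) → z ≢ [] → Listed t 0 z
factors-of-𝚊𝚋 t [] _ z≢[] = ⊥-elim (z≢[] refl)
factors-of-𝚊𝚋 t (c ∷ []) _ _ = inj₁ (c , refl)
factors-of-𝚊𝚋 t (a ∷ b ∷ z) z⊑ _ = inj₂ (0 , z≤n , factor-length-≡ z⊑ (ℕP.≤-antisym (factor-length z⊑) (s≤s (s≤s z≤n))))

σ-letter-listed : ∀ t i c → Listed t i (σ t ⋆ (c ∷ []))
σ-letter-listed true i 𝚊 = inj₁ (𝚊 , refl)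
σ-letter-listed true i 𝚋 = inj₂ (0 , z≤n , refl)
σ-letter-listed false i 𝚊 = inj₂ (0 , z≤n , refl)
σ-letter-listed false i 𝚋 = inj₁ (𝚋 , refl)

-- The Lyndon factors of fibLyndon t i are listed: a Lyndon factor of length ≥ 2
-- starts with 𝚊 and ends with 𝚋, so it desubstitutes to a Lyndon factor of the
-- previous word of the other family.
lyndon-factors-listed : ∀ t i z → Factor z (fibLyndon t i) → SuffixMinimal z → Listed t i z
lyndon-factors-listed t zero z z⊑ z-min = factors-of-𝚊𝚋 t z z⊑ (proj₁ z-min)
lyndon-factors-listed t (suc i) [] _ (z≢[] , _) = ⊥-elim (z≢[] refl)
lyndon-factors-listed t (suc i) (c ∷ []) _ _ = inj₁ (c , refl)
lyndon-factors-listed t (suc i) z@(c ∷ d ∷ r) z⊑ z-min with lyndon-starts-with-𝚊 z-min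
... | refl with Desubstitution.desubstitute (σ t) (σ-block t) z⊑ (d ∷ r , refl) (lyndon-ends-with-𝚋 z z-min (s≤s (s≤s z≤n)))
...   | z' , z'⊑ , σz'≡z with lyndon-factors-listed (not t) i z' z'⊑ (σ-Substitution.reflects-lyndon t z' (subst SuffixMinimal (sym σz'≡z) z-min))
...     | inj₁ (c' , refl) = subst (Listed t (suc i)) σz'≡z (σ-letter-listed t (suc i) c')
...     | inj₂ (j , j≤i , refl) = inj₂ (suc j , s≤s j≤i , sym σz'≡z)

-- The two families are different: fibLyndon (not t) (1 + j) is not a factor of
-- fibLyndon t (2 + j), because it contains the square 𝚋𝚋 resp. 𝚊𝚊 which the
-- other family avoids.
squared : Bool → Fin 2
squared true = 𝚊
squared false = 𝚋

square : Bool → Binary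
square t = squared t ∷ squared t ∷ []

SquareFree : Fin 2 → Binary → Set
SquareFree c (x ∷ y ∷ r) = ¬ (x ≡ c × y ≡ c) × SquareFree c (y ∷ r)
SquareFree c _ = ⊤

squareFree-tail : ∀ {c} x r → SquareFree c (x ∷ r) → SquareFree c r
squareFree-tail x [] _ = tt
squareFree-tail x (_ ∷ _) (_ , sf) = sf

squareFree-∷ : ∀ {c} d r → d ≢ c → SquareFree c r → SquareFree c (d ∷ r)
squareFree-∷ d [] _ _ = tt
squareFree-∷ d (_ ∷ _) d≢c sf = (λ (d≡c , _) → d≢c d≡c) , sf

squareFree⇒¬factor : ∀ c w → SquareFree c w → ¬ Factor (c ∷ c ∷ []) w
squareFree⇒¬factor c _ (sf , _) ([] , y , refl) = sf (refl , refl)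
squareFree⇒¬factor c _ sf (x ∷ xs , y , refl) = squareFree⇒¬factor c _ (squareFree-tail x _ sf) (xs , y , refl)

𝚊≢𝚋 : _≢_ {A = Fin 2} 𝚊 𝚋
𝚊≢𝚋 ()

-- σ false ⋆ x has no 𝚊𝚊: every 𝚊 is followed by 𝚋.
σfalse-no-𝚊𝚊 : ∀ x → SquareFree 𝚊 (σ false ⋆ x)
σfalse-no-𝚊𝚊 [] = tt
σfalse-no-𝚊𝚊 (𝚊 ∷ x) = (λ { (_ , ()) }) , squareFree-∷ 𝚋 _ (λ ()) (σfalse-no-𝚊𝚊 x)
σfalse-no-𝚊𝚊 (𝚋 ∷ x) = squareFree-∷ 𝚋 _ (λ ()) (σfalse-no-𝚊𝚊 x)

-- σ true ⋆ x has no 𝚋𝚋, even after a leading 𝚋: every image begins with 𝚊.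
σtrue-no-𝚋𝚋 : ∀ x → SquareFree 𝚋 (𝚋 ∷ σ true ⋆ x)
σtrue-no-𝚋𝚋 [] = tt
σtrue-no-𝚋𝚋 (𝚊 ∷ x) = (λ { (_ , ()) }) , squareFree-∷ 𝚊 _ 𝚊≢𝚋 (squareFree-tail 𝚋 _ (σtrue-no-𝚋𝚋 x))
σtrue-no-𝚋𝚋 (𝚋 ∷ x) = (λ { (_ , ()) }) , squareFree-∷ 𝚊 _ 𝚊≢𝚋 (σtrue-no-𝚋𝚋 x)

fibLyndon-avoids : ∀ t j → ¬ Factor (square (not t)) (fibLyndon t j)
fibLyndon-avoids t zero = squareFree⇒¬factor (squared (not t)) _ ((λ (e₁ , e₂) → 𝚊≢𝚋 (trans e₁ (sym e₂))) , tt)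
fibLyndon-avoids true (suc j) = squareFree⇒¬factor 𝚋 _ (squareFree-tail 𝚋 _ (σtrue-no-𝚋𝚋 (fibLyndon false j)))
fibLyndon-avoids false (suc j) = squareFree⇒¬factor 𝚊 _ (σfalse-no-𝚊𝚊 (fibLyndon true j))

σfalse-ends-with-𝚋 : ∀ x → x ≢ [] → EndsWith𝚋 (σ false ⋆ x)
σfalse-ends-with-𝚋 [] x≢[] = ⊥-elim (x≢[] refl)
σfalse-ends-with-𝚋 (𝚊 ∷ []) _ = 𝚊 ∷ [] , refl
σfalse-ends-with-𝚋 (𝚋 ∷ []) _ = [] , refl
σfalse-ends-with-𝚋 (c ∷ x@(_ ∷ _)) _ with σfalse-ends-with-𝚋 x (λ ())
... | q , e = σ false c ++ q , trans (cong (σ false c ++_) e) (sym (ListP.++-assoc (σ false c) q (𝚋 ∷ [])))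

fibLyndon-contains : ∀ t j → Factor (square t) (fibLyndon t (suc j))
fibLyndon-contains true j with fibLyndon-borders false j
... | [] , e = [] , 𝚋 ∷ [] , cong (σ true ⋆_) e
... | 𝚊 ∷ r , e = [] , _ , cong (σ true ⋆_) e
... | 𝚋 ∷ r , e = [] , _ , cong (σ true ⋆_) e
fibLyndon-contains false j with fibLyndon-borders true j
... | r , e with σfalse-ends-with-𝚋 (𝚊 ∷ r) (λ ())
...   | q , e' = q , [] , (begin
  σ false ⋆ fibLyndon true j          ≡⟨ cong (σ false ⋆_) e ⟩
  σ false ⋆ ((𝚊 ∷ r) ++ 𝚋 ∷ [])       ≡⟨ ⋆-++ (σ false) (𝚊 ∷ r) (𝚋 ∷ []) ⟩
  σ false ⋆ (𝚊 ∷ r) ++ 𝚋 ∷ []         ≡⟨ cong (_++ 𝚋 ∷ []) e' ⟩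
  (q ++ 𝚋 ∷ []) ++ 𝚋 ∷ []             ≡⟨ ListP.++-assoc q (𝚋 ∷ []) (𝚋 ∷ []) ⟩
  q ++ 𝚋 ∷ 𝚋 ∷ []                     ≡⟨ cong (q ++_) (sym (ListP.++-identityʳ (𝚋 ∷ 𝚋 ∷ []))) ⟩
  q ++ (𝚋 ∷ 𝚋 ∷ []) ++ []             ∎)
  where open ≡-Reasoning

fibLyndon-families-differ : ∀ t j → ¬ Factor (fibLyndon (not t) (suc j)) (fibLyndon t (suc (suc j)))
fibLyndon-families-differ t j fac = fibLyndon-avoids t (suc (suc j))
  (factor-trans (fibLyndon-contains (not t) j) fac)

letter : ∀ {k} → Fin k → Fin k → Fin 2 → Fin k
letter a b 𝚊 = a
letter a b 𝚋 = b

rename : ∀ {k} → Fin k → Fin k → Binary → Word k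
rename a b = map (letter a b)

module Renaming {k : ℕ} (a b : Fin k) (a<b : a <ᶠ b) where

  letter-injective : ∀ {c d} → letter a b c ≡ letter a b d → c ≡ d
  letter-injective {𝚊} {𝚊} _ = refl
  letter-injective {𝚊} {𝚋} a≡b = ⊥-elim (FinP.<-irrefl a≡b a<b)
  letter-injective {𝚋} {𝚊} b≡a = ⊥-elim (FinP.<-irrefl (sym b≡a) a<b)
  letter-injective {𝚋} {𝚋} _ = refl

  rename-injective : ∀ {x y} → rename a b x ≡ rename a b y → x ≡ y
  rename-injective = ListP.map-injective letter-injective

  rename-mono : ∀ {x y : Binary} → x <lex y → rename a b x <lex rename a b y
  rename-mono prefix = prefix
  rename-mono (here {𝚊} {𝚊} ())
  rename-mono (here {𝚊} {𝚋} _) = here a<b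
  rename-mono (here {𝚋} {𝚊} ())
  rename-mono (here {𝚋} {𝚋} (s≤s ()))
  rename-mono (there q) = there (rename-mono q)

  letter-reflects : ∀ c d → letter a b c <ᶠ letter a b d → c <ᶠ d
  letter-reflects 𝚊 𝚊 a<a = ⊥-elim (FinP.<-irrefl refl a<a)
  letter-reflects 𝚊 𝚋 _ = s≤s z≤n
  letter-reflects 𝚋 𝚊 b<a = ⊥-elim (FinP.<-asym b<a a<b)
  letter-reflects 𝚋 𝚋 b<b = ⊥-elim (FinP.<-irrefl refl b<b)

  rename-reflects : ∀ (x y : Binary) {u v} → u <lex v → u ≡ rename a b x → v ≡ rename a b y → x <lex y
  rename-reflects [] [] prefix _ ()
  rename-reflects [] (d ∷ y) prefix _ _ = prefix
  rename-reflects (c ∷ x) _ prefix () _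
  rename-reflects [] _ (here _) () _
  rename-reflects (c ∷ x) [] (here _) _ ()
  rename-reflects (c ∷ x) (d ∷ y) (here p) refl refl = here (letter-reflects c d p)
  rename-reflects [] _ (there _) () _
  rename-reflects (c ∷ x) [] (there _) _ ()
  rename-reflects (c ∷ x) (d ∷ y) (there q) e₁ e₂
    with letter-injective (trans (sym (ListP.∷-injectiveˡ e₁)) (ListP.∷-injectiveˡ e₂))
  ... | refl = there (rename-reflects x y q (ListP.∷-injectiveʳ e₁) (ListP.∷-injectiveʳ e₂))

  rename-split : ∀ (x : Binary) p q → rename a b x ≡ p ++ q →
    Σ Binary λ x₁ → Σ Binary λ x₂ → (x ≡ x₁ ++ x₂) × (rename a b x₁ ≡ p) × (rename a b x₂ ≡ q)
  rename-split x [] q eq = [] , x , refl , refl , eq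
  rename-split [] (c ∷ p) q ()
  rename-split (d ∷ x) (c ∷ p) q eq with rename-split x p q (ListP.∷-injectiveʳ eq)
  ... | x₁ , x₂ , refl , refl , refl = d ∷ x₁ , x₂ , refl , cong (_∷ rename a b x₁) (ListP.∷-injectiveˡ eq) , refl

  rename-lyndon : ∀ {x} → SuffixMinimal x → SuffixMinimal (rename a b x)
  rename-lyndon {x} (x≢[] , smaller) = (λ e → x≢[] (rename-injective e)) , renamed-smaller
    where
      renamed-smaller : ∀ p q → rename a b x ≡ p ++ q → p ≢ [] → q ≢ [] → rename a b x <lex q
      renamed-smaller p q eq p≢[] q≢[] with rename-split x p q eq
      ... | x₁ , x₂ , refl , refl , refl = rename-mono (smaller x₁ x₂ refl (λ { refl → p≢[] refl }) (λ { refl → q≢[] refl }))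

  rename-lyndon⁻ : ∀ {x} → SuffixMinimal (rename a b x) → SuffixMinimal x
  rename-lyndon⁻ {x} (x≢[] , smaller) = (λ { refl → x≢[] refl }) , original-smaller
    where
      original-smaller : ∀ p q → x ≡ p ++ q → p ≢ [] → q ≢ [] → x <lex q
      original-smaller p q refl p≢[] q≢[] =
        rename-reflects (p ++ q) q (smaller (rename a b p) (rename a b q) (ListP.map-++ (letter a b) p q)
          (λ e → p≢[] (rename-injective e)) (λ e → q≢[] (rename-injective e))) refl refl

  rename-factor⁻ : ∀ {z} (x : Binary) → Factor z (rename a b x) → Σ Binary λ z' → (z ≡ rename a b z') × Factor z' x
  rename-factor⁻ {z} x (p , s , eq) with rename-split x p (z ++ s) eq
  ... | x₁ , x' , refl , _ , e₃ with rename-split x' z s e₃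
  ...   | x₂ , x₃ , refl , e₅ , _ = x₂ , sym e₅ , x₁ , x₃ , refl

  rename-factor-reflects : ∀ {z x : Binary} → Factor (rename a b z) (rename a b x) → Factor z x
  rename-factor-reflects {z} {x} fac with rename-factor⁻ x fac
  ... | z' , eq , z'⊑x = subst (λ s → Factor s x) (sym (rename-injective eq)) z'⊑x

  rename-letters : ∀ {c} (x : Binary) → c ∈ rename a b x → c ≡ a ⊎ c ≡ b
  rename-letters x c∈ with ∈P.∈-map⁻ (letter a b) c∈
  ... | 𝚊 , _ , eq = inj₁ eq
  ... | 𝚋 , _ , eq = inj₂ eq

-- Fibonacci Lyndon words have few Lyndon factors

-- Every Lyndon factor of a renamed fibLyndon t i is a renamed listed word, and
-- there are i + 3 of those.
fibLyndon-count-≤ : ∀ {k} i (a b : Fin k) → a <ᶠ b → ∀ t (ls : List (Word k)) → Unique ls →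
  (∀ z → z ∈ ls → Factor z (rename a b (fibLyndon t i)) × Lyndon z) → length ls ≤ 3 + i
fibLyndon-count-≤ i a b a<b t ls unique lyndon-factors =
  subst (length ls ≤_) (trans (ListP.length-map (rename a b) (listing t i)) (listing-length t i))
    (unique-⊆⇒length-≤ _≟ʷ_ ls (map (rename a b) (listing t i)) unique ls⊆)
  where
    open Renaming a b a<b
    ls⊆ : ∀ z → z ∈ ls → z ∈ map (rename a b) (listing t i)
    ls⊆ z z∈ls with lyndon-factors z z∈ls
    ... | z⊑ , z-lyndon with rename-factor⁻ (fibLyndon t i) z⊑
    ...   | z' , refl , z'⊑ = ∈P.∈-map⁺ (rename a b)
      (listed⇒∈ t i z' (lyndon-factors-listed t i z' z'⊑ (rename-lyndon⁻ (lyndon⇒suffixMinimal z-lyndon))))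

-- Extremal Lyndon words are Fibonacci Lyndon words

squeeze : ∀ {a A b B : ℕ} → a ≤ A → b ≤ B → a + b ≡ A + B → (a ≡ A) × (b ≡ B)
squeeze {a} {A} {b} {B} a≤A b≤B eq with ℕP.m≤n⇒m<n∨m≡n a≤A
... | inj₂ a≡A = a≡A , ℕP.+-cancelˡ-≡ A b B (trans (cong (_+ b) (sym a≡A)) eq)
... | inj₁ a<A = ⊥-elim (ℕP.<-irrefl eq (ℕP.+-mono-<-≤ a<A b≤B))

products-conjugate : ∀ {k} {w w' u v : Word k} → Product w u v → Product w' u v → Conjugate w w'
products-conjugate {w = w} (in-order refl) (in-order refl) = [] , w , refl , sym (ListP.++-identityʳ w)
products-conjugate {w = w} (swapped refl) (swapped refl) = [] , w , refl , sym (ListP.++-identityʳ w)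
products-conjugate {u = u} {v} (in-order refl) (swapped refl) = u , v , refl , refl
products-conjugate {u = u} {v} (swapped refl) (in-order refl) = v , u , refl , refl

-- w is a Fibonacci Lyndon word of length F_{i+3} over some letters a < b.
IsFibonacci : ∀ {k} → ℕ → Word k → Set
IsFibonacci {k} i w = Σ (Fin k) λ a → Σ (Fin k) λ b → (a <ᶠ b) × Σ Bool λ t → w ≡ rename a b (fibLyndon t i)

module _ {k : ℕ} where

  record Tight (j : ℕ) (w : Word k) (ls : List (Word k)) : Set where
    field
      short long : Word k
      product : Product w short long
      short-minimal : SuffixMinimal short
      long-minimal : SuffixMinimal long
      short⊑long : Factor short long
      short-length : length short ≡ fib (2 + j)
      long-length : length long ≡ fib (3 + j)
      short-covers : Covers (restrict short ls) short
      long-covers : Covers (restrict long ls) long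
      short-count : 1 ≤ j → length (restrict short ls) ≡ 2 + j
      long-count : length (restrict long ls) ≡ 3 + j

  -- In the lower-bound argument all inequalities must be equalities.
  tight : ∀ j c (s : Word k) ls → s ≢ [] → SuffixMinimal (c ∷ s) → Covers ls (c ∷ s) →
    length ls ≡ 4 + j → length (c ∷ s) ≡ fib (4 + j) → Tight j (c ∷ s) ls
  tight j c s ls s≢[] w-min covers count w-length = record
    { short = u ; long = v ; product = product ; short-minimal = u-minimal ; long-minimal = v-minimal
    ; short⊑long = u⊑v ; short-length = proj₁ lengths ; long-length = proj₂ lengths
    ; short-covers = u-covers ; long-covers = v-covers ; short-count = u-count-≡ ; long-count = v-count-≡ }
    where
      open Split (lyndon-split c s ls s≢[] w-min covers)
      u-covers = covers-restrict covers (proj₁ (product-factors product))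
      v-covers = covers-restrict covers (proj₂ (product-factors product))
      u-bound : length u ≤ fib (length (restrict u ls))
      u-bound = length-≤-fib-cover (length u) u ℕP.≤-refl u-minimal (restrict u ls) u-covers
      v-bound : length v ≤ fib (length (restrict v ls))
      v-bound = length-≤-fib-cover (length v) v ℕP.≤-refl v-minimal (restrict v ls) v-covers
      u-count-≤ : length (restrict u ls) ≤ 2 + j
      u-count-≤ = ℕP.≤-pred (ℕP.≤-pred (subst (2 + length (restrict u ls) ≤_) count u-count))
      v-count-≤ : length (restrict v ls) ≤ 3 + j
      v-count-≤ = ℕP.≤-pred (subst (1 + length (restrict v ls) ≤_) count v-count)
      lengths : (length u ≡ fib (2 + j)) × (length v ≡ fib (3 + j))
      lengths = squeeze (ℕP.≤-trans u-bound (fib-mono u-count-≤)) (ℕP.≤-trans v-bound (fib-mono v-count-≤))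
        (trans (product-length product) (trans w-length (ℕP.+-comm (fib (3 + j)) (fib (2 + j)))))
      v-count-≡ : length (restrict v ls) ≡ 3 + j
      v-count-≡ = ℕP.≤-antisym v-count-≤ (fib-reflects-≤ (s≤s (s≤s (s≤s z≤n))) (subst (_≤ fib (length (restrict v ls))) (proj₂ lengths) v-bound))
      u-count-≡ : 1 ≤ j → length (restrict u ls) ≡ 2 + j
      u-count-≡ (s≤s z≤n) = ℕP.≤-antisym u-count-≤ (fib-reflects-≤ (s≤s (s≤s (s≤s z≤n))) (subst (_≤ fib (length (restrict u ls))) (proj₁ lengths) u-bound))
      -- Otherwise the restriction to v would also lose u.
      u⊑v : Factor u v
      u⊑v with factor? u v
      ... | yes u⊑v = u⊑v
      ... | no u⋢v = ⊥-elim (ℕP.<-irrefl refl (ℕP.≤-trans (s≤s (s≤s (ℕP.≤-reflexive (sym v-count-≡))))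
        (subst (2 + length (restrict v ls) ≤_) count
          (filter-drops-two (λ z → factor? z v) (covers (c ∷ s) (factor-refl (c ∷ s)) (suffixMinimal⇒lyndon w-min))
            (covers u (proj₁ (product-factors product)) (suffixMinimal⇒lyndon u-minimal))
            (λ e → ≢-by-length (product-< product (proj₁ v-minimal)) (sym e))
            (λ w⊑v → ℕP.<-irrefl refl (ℕP.≤-trans (product-< (product-swap product) (proj₁ u-minimal)) (factor-length w⊑v)))
            u⋢v))))

fibLyndon-factor-same : ∀ t t' j → Factor (fibLyndon t' j) (fibLyndon t (suc j)) → fibLyndon t' j ≡ fibLyndon t j
fibLyndon-factor-same t t' zero _ = refl
fibLyndon-factor-same true true (suc j) _ = refl
fibLyndon-factor-same false false (suc j) _ = refl
fibLyndon-factor-same true false (suc j) fac = ⊥-elim (fibLyndon-families-differ true j fac)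
fibLyndon-factor-same false true (suc j) fac = ⊥-elim (fibLyndon-families-differ false j fac)

product-map : ∀ {k l} (f : Fin k → Fin l) {w u v : Word k} → Product w u v → Product (map f w) (map f u) (map f v)
product-map f {u = u} {v} (in-order refl) = in-order (ListP.map-++ f u v)
product-map f {u = u} {v} (swapped refl) = swapped (ListP.map-++ f v u)

module _ {k : ℕ} where

  same-letters : ∀ {a b a' b' : Fin k} → a <ᶠ b → a' <ᶠ b' → (a' ≡ a ⊎ a' ≡ b) → (b' ≡ a ⊎ b' ≡ b) → (a' ≡ a) × (b' ≡ b)
  same-letters a<b a'<b' (inj₁ refl) (inj₁ refl) = ⊥-elim (FinP.<-irrefl refl a'<b')
  same-letters a<b a'<b' (inj₁ a'≡a) (inj₂ b'≡b) = a'≡a , b'≡b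
  same-letters a<b a'<b' (inj₂ refl) (inj₁ refl) = ⊥-elim (FinP.<-asym a<b a'<b')
  same-letters a<b a'<b' (inj₂ refl) (inj₂ refl) = ⊥-elim (FinP.<-irrefl refl a'<b')

  -- Index 0: a Lyndon word x y has x < y, so it is the renamed 𝚊𝚋.
  lyndon-of-length-2 : ∀ (x y : Fin k) → SuffixMinimal (x ∷ y ∷ []) → IsFibonacci 0 (x ∷ y ∷ [])
  lyndon-of-length-2 x y (_ , smaller) with smaller (x ∷ []) (y ∷ []) refl (λ ()) (λ ())
  ... | here x<y = x , y , x<y , true , refl
  ... | there ()

  -- Index 1: w = c a b or w = a b c with c ∈ {a , b}; only a a b and a b b are Lyndon.
  letter-times-fibonacci : ∀ (w short long : Word k) → SuffixMinimal w → Product w short long →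
    Factor short long → length short ≡ 1 → IsFibonacci 0 long → IsFibonacci 1 w
  letter-times-fibonacci w (c ∷ []) _ w-min prod c⊑long _ (a , b , a<b , _ , refl) =
    by-cases (factor-∈ c⊑long (here refl)) prod w-min
    where
      by-cases : ∀ {c w} → c ∈ (a ∷ b ∷ []) → Product w (c ∷ []) (a ∷ b ∷ []) → SuffixMinimal w → IsFibonacci 1 w
      by-cases (here refl) (in-order refl) _ = a , b , a<b , true , refl
      by-cases (there (here refl)) (swapped refl) _ = a , b , a<b , false , refl
      by-cases (here refl) (swapped refl) (_ , smaller) with smaller (a ∷ b ∷ []) (a ∷ []) refl (λ ()) (λ ())
      ... | here a<a = ⊥-elim (FinP.<-irrefl refl a<a)
      ... | there ()
      by-cases (there (here refl)) (in-order refl) (_ , smaller) with smaller (b ∷ []) (a ∷ b ∷ []) refl (λ ()) (λ ())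
      ... | here b<a = ⊥-elim (FinP.<-asym a<b b<a)
      ... | there _ = ⊥-elim (FinP.<-irrefl refl a<b)
  letter-times-fibonacci w [] _ _ _ _ () _
  letter-times-fibonacci w (_ ∷ _ ∷ _) _ _ _ _ () _

  -- Index 2 + j: the factor of index j lives in the same family and on the same
  -- letters as the one of index 1 + j, so w is a Lyndon conjugate of, hence
  -- equal to, the next word of that family.
  fibonacci-times-fibonacci : ∀ j (w short long : Word k) → SuffixMinimal w → Product w short long →
    Factor short long → IsFibonacci j short → IsFibonacci (1 + j) long → IsFibonacci (2 + j) w
  fibonacci-times-fibonacci j w _ _ w-min prod short⊑long (a' , b' , a'<b' , t' , refl) (a , b , a<b , t , refl)
    with same-letters a<b a'<b' (rename-letters (fibLyndon t (1 + j)) (factor-∈ short⊑long (proj₁ (letters a' b'))))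
                                (rename-letters (fibLyndon t (1 + j)) (factor-∈ short⊑long (proj₂ (letters a' b'))))
    where
      open Renaming a b a<b
      letters : ∀ a' b' → (a' ∈ rename a' b' (fibLyndon t' j)) × (b' ∈ rename a' b' (fibLyndon t' j))
      letters a' b' = ∈P.∈-map⁺ (letter a' b') (proj₁ (fibLyndon-letters t' j)) , ∈P.∈-map⁺ (letter a' b') (proj₂ (fibLyndon-letters t' j))
  ... | refl , refl = a , b , a<b , t ,
    lyndon-conjugates-≡ (suffixMinimal⇒lyndon w-min) (suffixMinimal⇒lyndon (rename-lyndon (fibLyndon-minimal t (2 + j))))
      (products-conjugate (subst (λ s → Product w (rename a b s) (rename a b (fibLyndon t (1 + j)))) same prod)
                          (product-map (letter a b) (product-swap (fibLyndon-product t j))))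
    where
      open Renaming a b a<b
      same : fibLyndon t' j ≡ fibLyndon t j
      same = fibLyndon-factor-same t t' j (rename-factor-reflects short⊑long)

  extremal-is-fibonacci : ∀ i (w : Word k) ls → SuffixMinimal w → Covers ls w →
    length ls ≡ 3 + i → length w ≡ fib (3 + i) → IsFibonacci i w
  extremal-is-fibonacci i [] _ (w≢[] , _) _ _ _ = ⊥-elim (w≢[] refl)
  extremal-is-fibonacci i (c ∷ []) _ _ _ _ w-length =
    ⊥-elim (ℕP.<-irrefl w-length (fib-mono {3} {3 + i} (s≤s (s≤s (s≤s z≤n)))))
  extremal-is-fibonacci zero (c ∷ d ∷ []) _ w-min _ _ _ = lyndon-of-length-2 c d w-min
  extremal-is-fibonacci zero (c ∷ d ∷ _ ∷ _) _ _ _ _ ()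
  extremal-is-fibonacci (suc zero) (c ∷ d ∷ s) ls w-min covers count w-length =
    letter-times-fibonacci (c ∷ d ∷ s) short long w-min product short⊑long short-length
      (extremal-is-fibonacci 0 long (restrict long ls) long-minimal long-covers long-count long-length)
    where open Tight (tight 0 c (d ∷ s) ls (λ ()) w-min covers count w-length)
  extremal-is-fibonacci (suc (suc j)) (c ∷ d ∷ s) ls w-min covers count w-length =
    fibonacci-times-fibonacci j (c ∷ d ∷ s) short long w-min product short⊑long
      (extremal-is-fibonacci j short (restrict short ls) short-minimal short-covers (short-count (s≤s z≤n)) short-length)
      (extremal-is-fibonacci (suc j) long (restrict long ls) long-minimal long-covers long-count long-length)
    where open Tight (tight (suc j) c (d ∷ s) ls (λ ()) w-min covers count w-length)

-- The families are the Fibonacci Lyndon words a p_n b and a c(p_n) b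

flip : Fin 2 → Fin 2
flip 𝚊 = 𝚋
flip 𝚋 = 𝚊

φ : Fin 2 → Binary
φ 𝚊 = 𝚊 ∷ 𝚋 ∷ []
φ 𝚋 = 𝚊 ∷ []

fibWord₂ : ℕ → Binary
fibWord₂ = fibWord 𝚊 𝚋

fibWord₂-φ : ∀ n → fibWord₂ (2 + n) ≡ φ ⋆ fibWord₂ (1 + n)
fibWord₂-φ zero = refl
fibWord₂-φ (suc zero) = refl
fibWord₂-φ (suc (suc n)) =
  trans (cong₂ _++_ (fibWord₂-φ (suc n)) (fibWord₂-φ n)) (sym (⋆-++ φ (fibWord₂ (2 + n)) (fibWord₂ (1 + n))))

fibWord-length : ∀ {k} (a b : Fin k) n → length (fibWord a b n) ≡ fib n
fibWord-length a b zero = refl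
fibWord-length a b (suc zero) = refl
fibWord-length a b (suc (suc zero)) = refl
fibWord-length a b (suc (suc (suc n))) =
  trans (ListP.length-++ (fibWord a b (suc (suc n)))) (cong₂ _+_ (fibWord-length a b (suc (suc n))) (fibWord-length a b (suc n)))

-- p_{i+3} over 𝚊, 𝚋, computed by p_3 = ε, p_{i+4} = φ(p_{i+3}) 𝚊.
pre : ℕ → Binary
pre zero = []
pre (suc i) = φ ⋆ pre i ++ 𝚊 ∷ []

-- Passing from f_{i+3} = p xy to f_{i+4} = φ(p) φ(xy) = p_{i+4} yx.
fibWord₂-pre-step : ∀ i {xy yx} → φ ⋆ xy ≡ 𝚊 ∷ yx → fibWord₂ (3 + i) ≡ pre i ++ xy → fibWord₂ (4 + i) ≡ pre (suc i) ++ yx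
fibWord₂-pre-step i {xy} {yx} φxy eq = begin
  fibWord₂ (4 + i)                ≡⟨ fibWord₂-φ (2 + i) ⟩
  φ ⋆ fibWord₂ (3 + i)            ≡⟨ cong (φ ⋆_) eq ⟩
  φ ⋆ (pre i ++ xy)               ≡⟨ ⋆-++ φ (pre i) xy ⟩
  φ ⋆ pre i ++ φ ⋆ xy             ≡⟨ cong (φ ⋆ pre i ++_) φxy ⟩
  φ ⋆ pre i ++ 𝚊 ∷ yx             ≡⟨ sym (ListP.++-assoc (φ ⋆ pre i) (𝚊 ∷ []) yx) ⟩
  (φ ⋆ pre i ++ 𝚊 ∷ []) ++ yx     ∎
  where open ≡-Reasoning

fibWord₂-pre : ∀ i → fibWord₂ (3 + i) ≡ pre i ++ 𝚊 ∷ 𝚋 ∷ [] ⊎ fibWord₂ (3 + i) ≡ pre i ++ 𝚋 ∷ 𝚊 ∷ []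
fibWord₂-pre zero = inj₁ refl
fibWord₂-pre (suc i) with fibWord₂-pre i
... | inj₁ eq = inj₂ (fibWord₂-pre-step i refl eq)
... | inj₂ eq = inj₁ (fibWord₂-pre-step i refl eq)

take-length-++ : ∀ {X : Set} (x y : List X) → take (length x) (x ++ y) ≡ x
take-length-++ [] y = refl
take-length-++ (c ∷ x) y = cong (c ∷_) (take-length-++ x y)

take-all-but-two : ∀ {X : Set} (p : List X) x y → take (length (p ++ x ∷ y ∷ []) ∸ 2) (p ++ x ∷ y ∷ []) ≡ p
take-all-but-two p x y =
  trans (cong (λ n → take (n ∸ 2) (p ++ x ∷ y ∷ [])) (ListP.length-++ p))
    (trans (cong (λ n → take n (p ++ x ∷ y ∷ [])) (ℕP.m+n∸n≡m (length p) 2)) (take-length-++ p (x ∷ y ∷ [])))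

pWord₂-pre : ∀ i → pWord 𝚊 𝚋 (3 + i) ≡ pre i
pWord₂-pre i = trans (cong (λ n → take (n ∸ 2) (fibWord₂ (3 + i))) (sym (fibWord-length 𝚊 𝚋 (3 + i))))
                     (drop-two (fibWord₂-pre i))
  where
    drop-two : ∀ {w} → w ≡ pre i ++ 𝚊 ∷ 𝚋 ∷ [] ⊎ w ≡ pre i ++ 𝚋 ∷ 𝚊 ∷ [] → take (length w ∸ 2) w ≡ pre i
    drop-two (inj₁ refl) = take-all-but-two (pre i) 𝚊 𝚋
    drop-two (inj₂ refl) = take-all-but-two (pre i) 𝚋 𝚊

σtrue-flip : ∀ x → σ true ⋆ map flip x ≡ φ ⋆ x
σtrue-flip [] = refl
σtrue-flip (𝚊 ∷ x) = cong (λ s → 𝚊 ∷ 𝚋 ∷ s) (σtrue-flip x)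
σtrue-flip (𝚋 ∷ x) = cong (𝚊 ∷_) (σtrue-flip x)

σfalse-flip : ∀ x → 𝚋 ∷ σ false ⋆ x ≡ map flip (φ ⋆ x) ++ 𝚋 ∷ []
σfalse-flip [] = refl
σfalse-flip (𝚊 ∷ x) = cong (λ s → 𝚋 ∷ 𝚊 ∷ s) (σfalse-flip x)
σfalse-flip (𝚋 ∷ x) = cong (𝚋 ∷_) (σfalse-flip x)

flipIf : Bool → Binary → Binary
flipIf true x = x
flipIf false x = map flip x

fibLyndon-pre : ∀ t i → fibLyndon t i ≡ 𝚊 ∷ flipIf t (pre i) ++ 𝚋 ∷ []
fibLyndon-pre true zero = refl
fibLyndon-pre false zero = refl
fibLyndon-pre true (suc i) = begin
  σ true ⋆ fibLyndon false i                       ≡⟨ cong (σ true ⋆_) (fibLyndon-pre false i) ⟩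
  𝚊 ∷ σ true ⋆ (map flip (pre i) ++ 𝚋 ∷ [])         ≡⟨ cong (𝚊 ∷_) (⋆-++ (σ true) (map flip (pre i)) (𝚋 ∷ [])) ⟩
  𝚊 ∷ σ true ⋆ map flip (pre i) ++ 𝚊 ∷ 𝚋 ∷ []        ≡⟨ cong (λ s → 𝚊 ∷ s ++ 𝚊 ∷ 𝚋 ∷ []) (σtrue-flip (pre i)) ⟩
  𝚊 ∷ φ ⋆ pre i ++ 𝚊 ∷ 𝚋 ∷ []                      ≡⟨ cong (𝚊 ∷_) (sym (ListP.++-assoc (φ ⋆ pre i) (𝚊 ∷ []) (𝚋 ∷ []))) ⟩
  𝚊 ∷ pre (suc i) ++ 𝚋 ∷ []                        ∎
  where open ≡-Reasoning
fibLyndon-pre false (suc i) = begin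
  σ false ⋆ fibLyndon true i                       ≡⟨ cong (σ false ⋆_) (fibLyndon-pre true i) ⟩
  𝚊 ∷ 𝚋 ∷ σ false ⋆ (pre i ++ 𝚋 ∷ [])              ≡⟨ cong (λ s → 𝚊 ∷ 𝚋 ∷ s) (⋆-++ (σ false) (pre i) (𝚋 ∷ [])) ⟩
  𝚊 ∷ (𝚋 ∷ σ false ⋆ pre i) ++ 𝚋 ∷ []               ≡⟨ cong (λ s → 𝚊 ∷ s ++ 𝚋 ∷ []) (σfalse-flip (pre i)) ⟩
  𝚊 ∷ (map flip (φ ⋆ pre i) ++ 𝚋 ∷ []) ++ 𝚋 ∷ []    ≡⟨ cong (λ s → 𝚊 ∷ s ++ 𝚋 ∷ []) (sym (ListP.map-++ flip (φ ⋆ pre i) (𝚊 ∷ []))) ⟩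
  𝚊 ∷ map flip (pre (suc i)) ++ 𝚋 ∷ []             ∎
  where open ≡-Reasoning

module FibonacciLetters {k : ℕ} (a b : Fin k) (a<b : a <ᶠ b) where

  fibWord-rename : ∀ n → fibWord a b n ≡ rename a b (fibWord₂ n)
  fibWord-rename zero = refl
  fibWord-rename (suc zero) = refl
  fibWord-rename (suc (suc zero)) = refl
  fibWord-rename (suc (suc (suc n))) = trans (cong₂ _++_ (fibWord-rename (suc (suc n))) (fibWord-rename (suc n)))
    (sym (ListP.map-++ (letter a b) (fibWord₂ (2 + n)) (fibWord₂ (1 + n))))

  pWord-rename : ∀ n → pWord a b n ≡ rename a b (pWord 𝚊 𝚋 n)
  pWord-rename n = trans (cong (take (fib n ∸ 2)) (fibWord-rename n)) (ListP.take-map (fib n ∸ 2) (fibWord₂ n))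

  swap-a : swapLetter a b a ≡ b
  swap-a with a FinP.≟ a
  ... | yes _ = refl
  ... | no a≢a = ⊥-elim (a≢a refl)

  swap-b : swapLetter a b b ≡ a
  swap-b with b FinP.≟ a
  ... | yes b≡a = ⊥-elim (FinP.<-irrefl (sym b≡a) a<b)
  ... | no _ with b FinP.≟ b
  ...   | yes _ = refl
  ...   | no b≢b = ⊥-elim (b≢b refl)

  cMorph-rename : ∀ x → cMorph a b (rename a b x) ≡ rename a b (map flip x)
  cMorph-rename [] = refl
  cMorph-rename (𝚊 ∷ x) = cong₂ _∷_ swap-a (cMorph-rename x)
  cMorph-rename (𝚋 ∷ x) = cong₂ _∷_ swap-b (cMorph-rename x)

  a-p-b : ∀ i → a ∷ (pWord a b (3 + i) ++ b ∷ []) ≡ rename a b (fibLyndon true i)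
  a-p-b i = begin
    a ∷ (pWord a b (3 + i) ++ b ∷ [])       ≡⟨ cong (λ p → a ∷ (p ++ b ∷ [])) (trans (pWord-rename (3 + i)) (cong (rename a b) (pWord₂-pre i))) ⟩
    a ∷ (rename a b (pre i) ++ b ∷ [])       ≡⟨ cong (a ∷_) (sym (ListP.map-++ (letter a b) (pre i) (𝚋 ∷ []))) ⟩
    rename a b (𝚊 ∷ pre i ++ 𝚋 ∷ [])         ≡⟨ cong (rename a b) (sym (fibLyndon-pre true i)) ⟩
    rename a b (fibLyndon true i)            ∎
    where open ≡-Reasoning

  a-cp-b : ∀ i → a ∷ (cMorph a b (pWord a b (3 + i)) ++ b ∷ []) ≡ rename a b (fibLyndon false i)
  a-cp-b i = begin
    a ∷ (cMorph a b (pWord a b (3 + i)) ++ b ∷ [])    ≡⟨ cong (λ p → a ∷ (cMorph a b p ++ b ∷ [])) (trans (pWord-rename (3 + i)) (cong (rename a b) (pWord₂-pre i))) ⟩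
    a ∷ (cMorph a b (rename a b (pre i)) ++ b ∷ [])  ≡⟨ cong (λ p → a ∷ (p ++ b ∷ [])) (cMorph-rename (pre i)) ⟩
    a ∷ (rename a b (map flip (pre i)) ++ b ∷ [])     ≡⟨ cong (a ∷_) (sym (ListP.map-++ (letter a b) (map flip (pre i)) (𝚋 ∷ []))) ⟩
    rename a b (𝚊 ∷ map flip (pre i) ++ 𝚋 ∷ [])       ≡⟨ cong (rename a b) (sym (fibLyndon-pre false i)) ⟩
    rename a b (fibLyndon false i)                     ∎
    where open ≡-Reasoning

fibLyndon⇔isFibonacci : ∀ {k} i (w : Word k) → FibLyndon (3 + i) w ⇔ IsFibonacci i w
fibLyndon⇔isFibonacci i w = mk⇔ to from
  where
    open FibonacciLetters
    to : FibLyndon (3 + i) w → IsFibonacci i w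
    to (a , b , a<b , inj₁ eq) = a , b , a<b , true , trans eq (a-p-b a b a<b i)
    to (a , b , a<b , inj₂ eq) = a , b , a<b , false , trans eq (a-cp-b a b a<b i)
    from : IsFibonacci i w → FibLyndon (3 + i) w
    from (a , b , a<b , true , eq) = a , b , a<b , inj₁ (trans eq (sym (a-p-b a b a<b i)))
    from (a , b , a<b , false , eq) = a , b , a<b , inj₂ (trans eq (sym (a-cp-b a b a<b i)))

theorem12 : (k : ℕ) (w : Word k) (n : ℕ) → 3 ≤ n → fib n ≤ length w → Lyndon w →
    ∀ m → LyndonCount w m → (n ≤ m) × ((m ≡ n) ⇔ FibLyndon n w)
theorem12 k w (suc (suc (suc i))) (s≤s (s≤s (s≤s z≤n))) Fn≤|w| w-lyndon m (ls , unique , members , |ls|≡m) =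
  n≤m , mk⇔ extremal fibonacci-count
  where
    n = 3 + i
    w-min = lyndon⇒suffixMinimal w-lyndon
    covers : Covers ls w
    covers z z⊑w z-lyndon = Equivalence.from (members z) (z⊑w , z-lyndon)
    |w|≤Fm : length w ≤ fib m
    |w|≤Fm = subst (λ l → length w ≤ fib l) |ls|≡m (length-≤-fib-cover (length w) w ℕP.≤-refl w-min ls covers)
    n≤m : n ≤ m
    n≤m = fib-reflects-≤ (s≤s (s≤s (s≤s z≤n))) (ℕP.≤-trans Fn≤|w| |w|≤Fm)
    extremal : m ≡ n → FibLyndon n w
    extremal m≡n = Equivalence.from (fibLyndon⇔isFibonacci i w)
      (extremal-is-fibonacci i w ls w-min covers (trans |ls|≡m m≡n)
        (ℕP.≤-antisym (subst (λ l → length w ≤ fib l) m≡n |w|≤Fm) Fn≤|w|))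
    fibonacci-count : FibLyndon n w → m ≡ n
    fibonacci-count fib-w with Equivalence.to (fibLyndon⇔isFibonacci i w) fib-w
    ... | a , b , a<b , t , w≡ = ℕP.≤-antisym (subst (_≤ n) |ls|≡m (fibLyndon-count-≤ i a b a<b t ls unique factors)) n≤m
      where
        factors : ∀ z → z ∈ ls → Factor z (rename a b (fibLyndon t i)) × Lyndon z
        factors z z∈ls with Equivalence.to (members z) z∈ls
        ... | z⊑w , z-lyndon = subst (Factor z) w≡ z⊑w , z-lyndon
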